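{- For the complete graph $K_n$ with $n\ge 2$, the expected number of connected components of the forest produced by the forest building process is $\frac{n(n-1)}{4n-6}$. For the complete bipartite graph $K_{s,t}$ (with $s,t\ge1$), the expected number of connected components of the forest produced by the forest building process is $\frac{st}{s+t-1}$.
   Context: Forest building process: let $G$ be a finite simple graph without isolated vertices, with $m$ edges. Choose an ordering $e_1,\dots,e_m$ of $E(G)$ uniformly at random among all $m!$ orderings. Start with the graph $S$ on vertex set $V(G)$ with no edges; for $j=1,\dots,m$ in turn, add $e_j$ to $S$ if and only if $e_j$ is incident to some vertex that is not incident to any $e_i$ with $i<j$. The final $S$ is a spanning forest of $G$. -}

module Defs where

open import Data.Nat using (ℕ; zero; suc; _+_; _*_; _∸_; _<ᵇ_)
open import Data.Fin using (Fin; toℕ; _↑ˡ_; _↑ʳ_; _≟_)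
open import Data.Bool using (Bool; true; false; _∧_; _∨_; not; if_then_else_)
open import Data.List using (List; []; _∷_; _++_; map; concatMap; filter; length; allFin)
open import Data.Bool.ListAction using (any)
open import Data.Nat.ListAction using (sum)
open import Data.Product using (_×_; _,_)
open import Relation.Nullary.Decidable using (⌊_⌋)

-- A graph on vertex set Fin n is given by its list of edges (each edge once).
Edge : ℕ → Set
Edge n = Fin n × Fin n

-- All orderings (permutations) of a list, by insertion.
-- For a list of m distinct edges this lists each of the m! orderings exactly once.
insertAll : {A : Set} → A → List A → List (List A)
insertAll x [] = (x ∷ []) ∷ []
insertAll x (y ∷ ys) = (x ∷ y ∷ ys) ∷ map (y ∷_) (insertAll x ys)

perms : {A : Set} → List A → List (List A)
perms [] = [] ∷ []
perms (x ∷ xs) = concatMap (insertAll x) (perms xs)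

_==_ : {n : ℕ} → Fin n → Fin n → Bool
u == v = ⌊ u ≟ v ⌋

elem : {n : ℕ} → Fin n → List (Fin n) → Bool
elem u seen = any (λ w → w == u) seen

-- Forest building process applied to an ordering e₁,…,e_m of the edges.
-- 'seen' = vertices incident to some earlier edge e_i (i < j), whether or not e_i was added.
-- e_j is added iff one of its endpoints is not in 'seen'.
buildFrom : {n : ℕ} → List (Fin n) → List (Edge n) → List (Edge n)
buildFrom seen [] = []
buildFrom seen ((u , v) ∷ es) =
  if not (elem u seen) ∨ not (elem v seen)
  then (u , v) ∷ buildFrom (u ∷ v ∷ seen) es
  else buildFrom (u ∷ v ∷ seen) es

forestOf : {n : ℕ} → List (Edge n) → List (Edge n)
forestOf = buildFrom []

step : {n : ℕ} → List (Edge n) → (Fin n → Bool) → (Fin n → Bool)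
step es R x = R x ∨ any (λ { (a , b) → (R a ∧ (x == b)) ∨ (R b ∧ (x == a)) }) es

iter : {n : ℕ} → ℕ → List (Edge n) → (Fin n → Bool) → (Fin n → Bool)
iter zero es R = R
iter (suc k) es R = step es (iter k es R)

reachable : {n : ℕ} → List (Edge n) → Fin n → Fin n → Bool
reachable {n} es v = iter n es (λ x → x == v)

-- Number of connected components of (Fin n, es): number of vertices v that are the
-- least vertex of their component (no vertex u < v is reachable from v).
isRep : {n : ℕ} → List (Edge n) → Fin n → Bool
isRep {n} es v = not (any (λ u → (toℕ u <ᵇ toℕ v) ∧ reachable es v u) (allFin n))

components : {n : ℕ} → List (Edge n) → ℕ
components {n} es = length (filter (λ v → Data.Bool.T? (isRep es v)) (allFin n))
  where import Data.Bool

-- Sum over all orderings of the number of components of the resulting forest.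
-- The expectation is  totalComponents es / length (perms es)  (uniform over the m! orderings).
totalComponents : {n : ℕ} → List (Edge n) → ℕ
totalComponents es = sum (map (λ ord → components (forestOf ord)) (perms es))

completeEdges : (n : ℕ) → List (Edge n)
completeEdges n = concatMap (λ i → concatMap (λ j → if toℕ i <ᵇ toℕ j then (i , j) ∷ [] else []) (allFin n)) (allFin n)

-- Complete bipartite graph K_{s,t} on Fin (s + t): parts {0..s-1} and {s..s+t-1}.
bipartiteEdges : (s t : ℕ) → List (Edge (s + t))
bipartiteEdges s t = concatMap (λ i → map (λ j → (i ↑ˡ t , s ↑ʳ j)) (allFin t)) (allFin s)

-- When an edge is added by the process, one of its endpoints has not been touched before and is
-- therefore still an isolated vertex of the forest; attaching it lowers the number of components
-- by exactly one. Since every vertex is eventually touched, comparing first touches with added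
-- edges shows that the final forest has as many components as there are edges whose two endpoints
-- were both untouched when the edge was processed, i.e. edges that come before every other edge
-- sharing an endpoint with them. In a uniformly random ordering an edge precedes the k edges it
-- touches (itself included) with probability 1/k, so when k is the same for every edge the
-- expected number of components is |E|/k. For K_n, k = 2n − 3 and |E| = n(n − 1)/2; for K_{s,t},
-- k = s + t − 1 and |E| = st.

module Submission where

open import Defs
open import Data.Nat using (ℕ; _+_; _*_; _∸_; _≥_)
open import Data.Product using (_×_)
open import Data.List using (length)
open import Relation.Binary.PropositionalEquality using (_≡_)

open import Data.Bool using (Bool; true; false; if_then_else_; T; T?; not; _∧_; _∨_)
open import Data.Bool.Properties using (T-≡; T-not-≡; T-∧; T-∨; ∧-zeroʳ; ∧-identityʳ; ∨-identityʳ; ∨-comm; ∨-idem)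
open import Data.Bool.Solver using (module ∨-∧-Solver)
open import Data.Empty using (⊥-elim)
open import Data.Fin using (Fin; _≟_; toℕ; _↑ˡ_; _↑ʳ_; splitAt)
import Data.Fin as Fin
open import Data.Fin.Properties
  using ( any?; toℕ<n; toℕ-injective; ↑ˡ-injective; ↑ʳ-injective
        ; splitAt-↑ˡ; splitAt-↑ʳ; splitAt⁻¹-↑ˡ; splitAt⁻¹-↑ʳ)
open import Data.List
  using (List; []; _∷_; _++_; map; concatMap; filter; allFin; cartesianProductWith; cartesianProduct)
open import Data.List.Properties using (map-++; map-∘; length-map; length-tabulate; ++-identityʳ; filter-++)
open import Data.List.Membership.Propositional using (_∈_; find)
open import Data.List.Membership.Propositional.Properties
  using ( ∈-allFin; ∈-map⁺; ∈-map⁻; ∈-concatMap⁻; ∈-∃++; ∈-++⁻; ∈-filter⁺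
        ; ∈-cartesianProductWith⁺; ∈-cartesianProductWith⁻; ∈-cartesianProduct⁺)
open import Data.List.Relation.Unary.All using (All; []; _∷_)
import Data.List.Relation.Unary.All as All
import Data.List.Relation.Unary.All.Properties as All
open import Data.List.Relation.Unary.AllPairs using (_∷_)
open import Data.List.Relation.Unary.Any using (Any; here; there)
import Data.List.Relation.Unary.Any as Any
open import Data.List.Relation.Unary.Any.Properties using (any⁺; any⁻)
open import Data.List.Relation.Unary.Unique.Propositional using (Unique)
import Data.List.Relation.Unary.Unique.Propositional.Properties as Unique
open import Data.List.Relation.Binary.Permutation.Propositional
  using (_↭_; prep; swap; ↭-sym; ↭⇒↭ₛ) renaming (refl to ↭-refl; trans to ↭-trans)
import Data.List.Relation.Binary.Permutation.Propositional.Properties as ↭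
import Data.List.Relation.Binary.Permutation.Setoid.Properties as ↭ₛ
open import Data.Nat using (zero; suc; _≤_; _<_; z≤n; s≤s; _<ᵇ_)
open import Data.Nat.ListAction using (sum)
open import Data.Nat.ListAction.Properties using (sum-↭; sum-++)
open import Data.Nat.Properties hiding (_≟_)
open import Data.Nat.Tactic.RingSolver using (solve-∀)
open import Data.Product using (_,_; ∃; ∃₂; proj₁; proj₂)
open import Data.Product.Properties using (≡-dec)
open import Data.Sum using (_⊎_; inj₁; inj₂)
open import Data.Unit using (tt)
open import Function using (_∘_; case_of_)
open import Function.Bundles using (Equivalence)
open import Relation.Binary.Definitions using (DecidableEquality; tri<; tri≈; tri>)
open import Relation.Binary.PropositionalEquality
  using (_≢_; refl; sym; trans; cong; cong₂; subst; setoid; module ≡-Reasoning)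
open import Relation.Nullary using (¬_; Dec; yes; no)
import Relation.Nullary.Decidable as Dec
open import Relation.Nullary.Decidable
  using (⌊_⌋; isYes≗does; dec-true; dec-false; toWitness; fromWitness; _×-dec_; _⊎-dec_; ¬?)
open ≡-Reasoning

⟦_⟧ : Bool → ℕ
⟦ true ⟧ = 1
⟦ false ⟧ = 0

⟦∨⟧+⟦∧⟧ : (a b : Bool) → ⟦ a ∨ b ⟧ + ⟦ a ⟧ * ⟦ b ⟧ ≡ ⟦ a ⟧ + ⟦ b ⟧
⟦∨⟧+⟦∧⟧ false false = refl
⟦∨⟧+⟦∧⟧ false true = refl
⟦∨⟧+⟦∧⟧ true false = refl
⟦∨⟧+⟦∧⟧ true true = refl

⟦⟧-mono : {a b : Bool} → (T a → T b) → ⟦ a ⟧ ≤ ⟦ b ⟧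
⟦⟧-mono {false} _ = z≤n
⟦⟧-mono {true} {false} a⇒b = ⊥-elim (a⇒b tt)
⟦⟧-mono {true} {true} _ = s≤s z≤n

⟦⟧≤1 : (a : Bool) → ⟦ a ⟧ ≤ 1
⟦⟧≤1 false = z≤n
⟦⟧≤1 true = s≤s z≤n

T-∨ˡ : {a : Bool} (b : Bool) → T a → T (a ∨ b)
T-∨ˡ {true} b _ = tt

T-∨ʳ : (a : Bool) {b : Bool} → T b → T (a ∨ b)
T-∨ʳ false t = t
T-∨ʳ true _ = tt

T-not-intro : {b : Bool} → ¬ T b → T (not b)
T-not-intro {false} _ = tt
T-not-intro {true} ¬b = ¬b tt

T-not-elim : {b : Bool} → T (not b) → ¬ T b
T-not-elim {false} _ ()

¬T-not-elim : {b : Bool} → ¬ T (not b) → T b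
¬T-not-elim {false} ¬nb = ¬nb tt
¬T-not-elim {true} _ = tt

<ᵇ-true : {m n : ℕ} → m < n → (m <ᵇ n) ≡ true
<ᵇ-true = Equivalence.to T-≡ ∘ <⇒<ᵇ

<ᵇ-false : {m n : ℕ} → ¬ m < n → (m <ᵇ n) ≡ false
<ᵇ-false {m} {n} m≮n = Equivalence.to T-not-≡ (T-not-intro (m≮n ∘ <ᵇ⇒< m n))

T-ext : {a b : Bool} → (T a → T b) → (T b → T a) → a ≡ b
T-ext {false} {false} _ _ = refl
T-ext {false} {true} _ b⇒a = ⊥-elim (b⇒a tt)
T-ext {true} {false} a⇒b _ = ⊥-elim (a⇒b tt)
T-ext {true} {true} _ _ = refl

T-== : {n : ℕ} {x y : Fin n} → T (x == y) → x ≡ y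
T-== {x = x} {y} = toWitness {a? = x ≟ y}

T-==-refl : {n : ℕ} (x : Fin n) → T (x == x)
T-==-refl x = fromWitness {a? = x ≟ x} refl

module _ {A : Set} (_≟_ : DecidableEquality A) where

  ⌊≟⌋-refl : (x : A) → ⌊ x ≟ x ⌋ ≡ true
  ⌊≟⌋-refl x = trans (isYes≗does (x ≟ x)) (dec-true (x ≟ x) refl)

  ⌊≟⌋-≢ : {x y : A} → x ≢ y → ⌊ x ≟ y ⌋ ≡ false
  ⌊≟⌋-≢ {x} {y} x≢y = trans (isYes≗does (x ≟ y)) (dec-false (x ≟ y) x≢y)

length-allFin : (n : ℕ) → length (allFin n) ≡ n
length-allFin n = length-tabulate (λ i → i)

concatMap-map≡cartesianProductWith : {A B C : Set} (f : A → B → C) (xs : List A) (ys : List B) →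
  concatMap (λ x → map (f x) ys) xs ≡ cartesianProductWith f xs ys
concatMap-map≡cartesianProductWith f [] ys = refl
concatMap-map≡cartesianProductWith f (x ∷ xs) ys = cong (map (f x) ys ++_) (concatMap-map≡cartesianProductWith f xs ys)

Unique-resp-↭ : {A : Set} {xs ys : List A} → xs ↭ ys → Unique xs → Unique ys
Unique-resp-↭ {A} p = ↭ₛ.Unique-resp-↭ (setoid A) (↭⇒↭ₛ p)

-- Finite sums

module _ {A : Set} where

  ∑ : List A → (A → ℕ) → ℕ
  ∑ xs f = sum (map f xs)

  syntax ∑ xs (λ x → e) = ∑[ x ∈ xs ] e

  ∑-++ : (xs ys : List A) (f : A → ℕ) → ∑ (xs ++ ys) f ≡ ∑ xs f + ∑ ys f
  ∑-++ xs ys f = trans (cong sum (map-++ f xs ys)) (sum-++ (map f xs) (map f ys))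

  ∑-cong : (xs : List A) {f g : A → ℕ} → (∀ x → x ∈ xs → f x ≡ g x) → ∑ xs f ≡ ∑ xs g
  ∑-cong [] eq = refl
  ∑-cong (x ∷ xs) eq = cong₂ _+_ (eq x (here refl)) (∑-cong xs (λ y y∈ → eq y (there y∈)))

  ∑-+ : (xs : List A) (f g : A → ℕ) → ∑[ x ∈ xs ] (f x + g x) ≡ ∑ xs f + ∑ xs g
  ∑-+ [] f g = refl
  ∑-+ (x ∷ xs) f g = trans (cong (f x + g x +_) (∑-+ xs f g)) (+-+-swap (f x) (g x) _ _)
    where
    +-+-swap : ∀ a b c d → a + b + (c + d) ≡ a + c + (b + d)
    +-+-swap = solve-∀

  ∑-*ˡ : (xs : List A) (c : ℕ) (f : A → ℕ) → ∑[ x ∈ xs ] (c * f x) ≡ c * ∑ xs f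
  ∑-*ˡ [] c f = sym (*-zeroʳ c)
  ∑-*ˡ (x ∷ xs) c f = trans (cong (c * f x +_) (∑-*ˡ xs c f)) (sym (*-distribˡ-+ c (f x) _))

  ∑-*ʳ : (xs : List A) (f : A → ℕ) (c : ℕ) → ∑[ x ∈ xs ] (f x * c) ≡ ∑ xs f * c
  ∑-*ʳ xs f c = trans (∑-cong xs λ x _ → *-comm (f x) c) (trans (∑-*ˡ xs c f) (*-comm c (∑ xs f)))

  ∑-const : (xs : List A) (c : ℕ) → ∑[ x ∈ xs ] c ≡ length xs * c
  ∑-const [] c = refl
  ∑-const (x ∷ xs) c = cong (c +_) (∑-const xs c)

  length≡∑1 : (xs : List A) → length xs ≡ ∑[ x ∈ xs ] 1
  length≡∑1 xs = sym (trans (∑-const xs 1) (*-identityʳ (length xs)))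

  ∑-zero : (xs : List A) {f : A → ℕ} → (∀ x → x ∈ xs → f x ≡ 0) → ∑ xs f ≡ 0
  ∑-zero xs eq = trans (∑-cong xs eq) (trans (∑-const xs 0) (*-zeroʳ (length xs)))

  ∑-mono-≤ : (xs : List A) {f g : A → ℕ} → (∀ x → f x ≤ g x) → ∑ xs f ≤ ∑ xs g
  ∑-mono-≤ [] le = z≤n
  ∑-mono-≤ (x ∷ xs) le = +-mono-≤ (le x) (∑-mono-≤ xs le)

  ∑-mono-< : (xs : List A) {f g : A → ℕ} {y : A} → (∀ x → f x ≤ g x) → y ∈ xs → f y < g y → ∑ xs f < ∑ xs g
  ∑-mono-< (x ∷ xs) le (here refl) lt = +-mono-<-≤ lt (∑-mono-≤ xs le)
  ∑-mono-< (x ∷ xs) le (there y∈) lt = +-mono-≤-< (le x) (∑-mono-< xs le y∈ lt)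

  ∑-↭ : {xs ys : List A} (f : A → ℕ) → xs ↭ ys → ∑ xs f ≡ ∑ ys f
  ∑-↭ f p = sum-↭ (↭.map⁺ f p)

module _ {A B : Set} where

  ∑-map : (g : A → B) (xs : List A) (f : B → ℕ) → ∑ (map g xs) f ≡ ∑[ x ∈ xs ] f (g x)
  ∑-map g xs f = cong sum (sym (map-∘ xs))

  ∑-concatMap : (g : A → List B) (xs : List A) (f : B → ℕ) →
    ∑ (concatMap g xs) f ≡ ∑[ x ∈ xs ] ∑ (g x) f
  ∑-concatMap g [] f = refl
  ∑-concatMap g (x ∷ xs) f = trans (∑-++ (g x) (concatMap g xs) f) (cong (∑ (g x) f +_) (∑-concatMap g xs f))

  ∑-comm : (xs : List A) (ys : List B) (f : A → B → ℕ) →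
    ∑[ x ∈ xs ] ∑[ y ∈ ys ] f x y ≡ ∑[ y ∈ ys ] ∑[ x ∈ xs ] f x y
  ∑-comm [] ys f = sym (∑-zero ys (λ _ _ → refl))
  ∑-comm (x ∷ xs) ys f = trans (cong (∑ ys (f x) +_) (∑-comm xs ys f)) (sym (∑-+ ys (f x) _))

module _ {A B C : Set} where

  ∑-cartesianProductWith : (f : A → B → C) (xs : List A) (ys : List B) (g : C → ℕ) →
    ∑ (cartesianProductWith f xs ys) g ≡ ∑[ x ∈ xs ] ∑[ y ∈ ys ] g (f x y)
  ∑-cartesianProductWith f [] ys g = refl
  ∑-cartesianProductWith f (x ∷ xs) ys g = trans (∑-++ (map (f x) ys) _ g)
    (cong₂ _+_ (∑-map (f x) ys g) (∑-cartesianProductWith f xs ys g))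

module _ {A : Set} {P : A → Set} (P? : (x : A) → Dec (P x)) where

  ∑-filter : (xs : List A) (f : A → ℕ) → ∑ (filter P? xs) f ≡ ∑[ x ∈ xs ] (⟦ Dec.does (P? x) ⟧ * f x)
  ∑-filter [] f = refl
  ∑-filter (x ∷ xs) f with Dec.does (P? x)
  ... | true = cong₂ _+_ (sym (+-identityʳ (f x))) (∑-filter xs f)
  ... | false = ∑-filter xs f

module _ {A B : Set} where

  -- inclusion–exclusion for the union of a row set and a column set in xs × ys
  ∑∑-∨ : (xs : List A) (ys : List B) (p : A → Bool) (q : B → Bool) →
    ∑[ x ∈ xs ] ∑[ y ∈ ys ] ⟦ p x ∨ q y ⟧ + ∑[ x ∈ xs ] ⟦ p x ⟧ * ∑[ y ∈ ys ] ⟦ q y ⟧ ≡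
    length ys * ∑[ x ∈ xs ] ⟦ p x ⟧ + length xs * ∑[ y ∈ ys ] ⟦ q y ⟧
  ∑∑-∨ xs ys p q = begin
    ∑[ x ∈ xs ] ∑[ y ∈ ys ] ⟦ p x ∨ q y ⟧ + P * Q
      ≡⟨ cong (∑[ x ∈ xs ] ∑[ y ∈ ys ] ⟦ p x ∨ q y ⟧ +_) product ⟨
    ∑[ x ∈ xs ] ∑[ y ∈ ys ] ⟦ p x ∨ q y ⟧ + ∑[ x ∈ xs ] ∑[ y ∈ ys ] (⟦ p x ⟧ * ⟦ q y ⟧)
      ≡⟨ trans (∑-cong xs λ x _ → ∑-+ ys _ _) (∑-+ xs _ _) ⟨
    ∑[ x ∈ xs ] ∑[ y ∈ ys ] (⟦ p x ∨ q y ⟧ + ⟦ p x ⟧ * ⟦ q y ⟧)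
      ≡⟨ ∑-cong xs (λ x _ → ∑-cong ys λ y _ → ⟦∨⟧+⟦∧⟧ (p x) (q y)) ⟩
    ∑[ x ∈ xs ] ∑[ y ∈ ys ] (⟦ p x ⟧ + ⟦ q y ⟧)
      ≡⟨ ∑-cong xs (λ x _ → trans (∑-+ ys _ _) (cong (_+ Q) (trans (∑-const ys _) (*-comm (length ys) _)))) ⟩
    ∑[ x ∈ xs ] (⟦ p x ⟧ * length ys + Q)
      ≡⟨ ∑-+ xs _ _ ⟩
    ∑[ x ∈ xs ] (⟦ p x ⟧ * length ys) + ∑[ x ∈ xs ] Q
      ≡⟨ cong₂ _+_ (∑-*ʳ xs _ (length ys)) (∑-const xs Q) ⟩
    P * length ys + length xs * Q
      ≡⟨ cong (_+ length xs * Q) (*-comm P (length ys)) ⟩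
    length ys * P + length xs * Q ∎
    where
    P = ∑[ x ∈ xs ] ⟦ p x ⟧
    Q = ∑[ y ∈ ys ] ⟦ q y ⟧
    product : ∑[ x ∈ xs ] ∑[ y ∈ ys ] (⟦ p x ⟧ * ⟦ q y ⟧) ≡ P * Q
    product = trans (∑-cong xs λ x _ → ∑-*ˡ ys ⟦ p x ⟧ _) (∑-*ʳ xs _ Q)

module _ {A : Set} (_≟_ : DecidableEquality A) where

  ∑-δ : {xs : List A} {m : A} → Unique xs → m ∈ xs → (g : A → ℕ) →
    ∑[ x ∈ xs ] (⟦ ⌊ x ≟ m ⌋ ⟧ * g x) ≡ g m
  ∑-δ {m ∷ xs} (m∉xs ∷ _) (here refl) g rewrite ⌊≟⌋-refl _≟_ m =
    trans (cong (g m + 0 +_) (∑-zero xs λ x x∈ → cong (λ b → ⟦ b ⟧ * g x) (⌊≟⌋-≢ _≟_ (x≢m x∈))))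
      (trans (+-identityʳ _) (+-identityʳ _))
    where
    x≢m : ∀ {x} → x ∈ xs → x ≢ m
    x≢m x∈ x≡m = All.lookup m∉xs x∈ (sym x≡m)
  ∑-δ {x ∷ xs} (x∉xs ∷ uniq) (there m∈) g rewrite ⌊≟⌋-≢ _≟_ (All.lookup x∉xs m∈) = ∑-δ uniq m∈ g

  ∑-δ₁ : {xs : List A} {m : A} → Unique xs → m ∈ xs → ∑[ x ∈ xs ] ⟦ ⌊ x ≟ m ⌋ ⟧ ≡ 1
  ∑-δ₁ {xs} uniq m∈ = trans (∑-cong xs λ x _ → sym (*-identityʳ ⟦ ⌊ x ≟ _ ⌋ ⟧)) (∑-δ uniq m∈ (λ _ → 1))

-- Orderings

module _ {A : Set} where

  ∑-perms-∷ : (x : A) (xs : List A) (g : List A → ℕ) →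
    ∑ (perms (x ∷ xs)) g ≡ ∑[ τ ∈ perms xs ] ∑ (insertAll x τ) g
  ∑-perms-∷ x xs = ∑-concatMap (insertAll x) (perms xs)

  -- inserting x and then y, or y and then x, produces the same orderings
  ∑-insertAll-comm : (x y : A) (τ : List A) (g : List A → ℕ) →
    ∑[ ρ ∈ insertAll y τ ] ∑ (insertAll x ρ) g ≡ ∑[ ρ ∈ insertAll x τ ] ∑ (insertAll y ρ) g
  ∑-insertAll-comm x y [] g = swap-two (g (x ∷ y ∷ [])) (g (y ∷ x ∷ []))
    where
    swap-two : ∀ a b → a + (b + 0) + 0 ≡ b + (a + 0) + 0
    swap-two = solve-∀
  ∑-insertAll-comm x y (z ∷ zs) g = begin
    ∑[ ρ ∈ insertAll y (z ∷ zs) ] ∑ (insertAll x ρ) g  ≡⟨ expand x y ⟩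
    gxy + (gyx + cx) + (dy + exy)                      ≡⟨ rearrange gxy gyx cx dy exy ⟩
    gyx + (gxy + dy) + (cx + exy)                      ≡⟨ cong (λ w → gyx + (gxy + dy) + (cx + w)) exy≡eyx ⟩
    gyx + (gxy + dy) + (cx + eyx)                      ≡⟨ expand y x ⟨
    ∑[ ρ ∈ insertAll x (z ∷ zs) ] ∑ (insertAll y ρ) g  ∎
    where
    rearrange : ∀ a b c d e → a + (b + c) + (d + e) ≡ b + (a + d) + (c + e)
    rearrange = solve-∀
    gxy = g (x ∷ y ∷ z ∷ zs)
    gyx = g (y ∷ x ∷ z ∷ zs)
    cx = ∑[ σ ∈ insertAll x zs ] g (y ∷ z ∷ σ)
    dy = ∑[ ρ ∈ insertAll y zs ] g (x ∷ z ∷ ρ)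
    exy = ∑[ ρ ∈ insertAll y zs ] ∑[ σ ∈ insertAll x ρ ] g (z ∷ σ)
    eyx = ∑[ ρ ∈ insertAll x zs ] ∑[ σ ∈ insertAll y ρ ] g (z ∷ σ)
    exy≡eyx : exy ≡ eyx
    exy≡eyx = ∑-insertAll-comm x y zs (g ∘ (z ∷_))
    ∑-insertAll-∷ : (u : A) (ρ : List A) (h : List A → ℕ) →
      ∑ (insertAll u (z ∷ ρ)) h ≡ h (u ∷ z ∷ ρ) + ∑[ σ ∈ insertAll u ρ ] h (z ∷ σ)
    ∑-insertAll-∷ u ρ h = cong (h (u ∷ z ∷ ρ) +_) (∑-map (z ∷_) (insertAll u ρ) h)
    expand : (u v : A) →
      ∑[ ρ ∈ insertAll v (z ∷ zs) ] ∑ (insertAll u ρ) g ≡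
        g (u ∷ v ∷ z ∷ zs) + (g (v ∷ u ∷ z ∷ zs) + ∑[ σ ∈ insertAll u zs ] g (v ∷ z ∷ σ))
        + (∑[ ρ ∈ insertAll v zs ] g (u ∷ z ∷ ρ) + ∑[ ρ ∈ insertAll v zs ] ∑[ σ ∈ insertAll u ρ ] g (z ∷ σ))
    expand u v = cong₂ _+_
      (cong (g (u ∷ v ∷ z ∷ zs) +_)
        (trans (∑-map (v ∷_) (insertAll u (z ∷ zs)) g) (∑-insertAll-∷ u zs (g ∘ (v ∷_)))))
      (trans (∑-map (z ∷_) (insertAll v zs) (λ ρ → ∑ (insertAll u ρ) g))
        (trans (∑-cong (insertAll v zs) (λ ρ _ → ∑-insertAll-∷ u ρ g))
          (∑-+ (insertAll v zs) _ _)))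

  ∑-perms-↭ : {xs ys : List A} → xs ↭ ys → (g : List A → ℕ) → ∑ (perms xs) g ≡ ∑ (perms ys) g
  ∑-perms-↭ ↭-refl g = refl
  ∑-perms-↭ (prep {xs} {ys} x p) g = begin
    ∑ (perms (x ∷ xs)) g                    ≡⟨ ∑-perms-∷ x xs g ⟩
    ∑[ τ ∈ perms xs ] ∑ (insertAll x τ) g   ≡⟨ ∑-perms-↭ p _ ⟩
    ∑[ τ ∈ perms ys ] ∑ (insertAll x τ) g   ≡⟨ ∑-perms-∷ x ys g ⟨
    ∑ (perms (x ∷ ys)) g                    ∎
  ∑-perms-↭ (swap {xs} {ys} x y p) g = begin
    ∑ (perms (x ∷ y ∷ xs)) g
      ≡⟨ trans (∑-perms-∷ x (y ∷ xs) g) (∑-perms-∷ y xs _) ⟩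
    ∑[ ρ ∈ perms xs ] ∑[ τ ∈ insertAll y ρ ] ∑ (insertAll x τ) g
      ≡⟨ ∑-cong (perms xs) (λ ρ _ → ∑-insertAll-comm x y ρ g) ⟩
    ∑[ ρ ∈ perms xs ] ∑[ τ ∈ insertAll x ρ ] ∑ (insertAll y τ) g
      ≡⟨ ∑-perms-↭ p _ ⟩
    ∑[ ρ ∈ perms ys ] ∑[ τ ∈ insertAll x ρ ] ∑ (insertAll y τ) g
      ≡⟨ trans (∑-perms-∷ y (x ∷ ys) g) (∑-perms-∷ x ys _) ⟨
    ∑ (perms (y ∷ x ∷ ys)) g ∎
  ∑-perms-↭ (↭-trans p q) g = trans (∑-perms-↭ p g) (∑-perms-↭ q g)

  length-perms-↭ : {xs ys : List A} → xs ↭ ys → length (perms xs) ≡ length (perms ys)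
  length-perms-↭ {xs} {ys} p = begin
    length (perms xs)      ≡⟨ length≡∑1 (perms xs) ⟩
    ∑[ σ ∈ perms xs ] 1    ≡⟨ ∑-perms-↭ p _ ⟩
    ∑[ σ ∈ perms ys ] 1    ≡⟨ length≡∑1 (perms ys) ⟨
    length (perms ys)      ∎

  length-insertAll : (x : A) (τ : List A) → length (insertAll x τ) ≡ suc (length τ)
  length-insertAll x [] = refl
  length-insertAll x (y ∷ ys) = cong suc (trans (length-map (y ∷_) (insertAll x ys)) (length-insertAll x ys))

  ∈-insertAll⇒↭ : (x : A) (τ : List A) {σ : List A} → σ ∈ insertAll x τ → σ ↭ x ∷ τ
  ∈-insertAll⇒↭ x [] (here refl) = ↭-refl
  ∈-insertAll⇒↭ x (y ∷ ys) (here refl) = ↭-refl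
  ∈-insertAll⇒↭ x (y ∷ ys) (there σ∈) with ∈-map⁻ (y ∷_) σ∈
  ... | ρ , ρ∈ , refl = ↭-trans (prep y (∈-insertAll⇒↭ x ys ρ∈)) (swap y x ↭-refl)

  ∈-perms⇒↭ : (xs : List A) {σ : List A} → σ ∈ perms xs → σ ↭ xs
  ∈-perms⇒↭ [] (here refl) = ↭-refl
  ∈-perms⇒↭ (x ∷ xs) σ∈ with find (∈-concatMap⁻ (insertAll x) {xs = perms xs} σ∈)
  ... | τ , τ∈ , σ∈τ = ↭-trans (∈-insertAll⇒↭ x τ σ∈τ) (prep x (∈-perms⇒↭ xs τ∈))

  ∑-perms-∷-uniform : (x : A) (xs : List A) (g : List A → ℕ) →
    (∀ τ → ∑ (insertAll x τ) g ≡ suc (length τ) * g τ) →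
    ∑ (perms (x ∷ xs)) g ≡ suc (length xs) * ∑ (perms xs) g
  ∑-perms-∷-uniform x xs g uniform = begin
    ∑ (perms (x ∷ xs)) g                          ≡⟨ ∑-perms-∷ x xs g ⟩
    ∑[ τ ∈ perms xs ] ∑ (insertAll x τ) g
      ≡⟨ ∑-cong (perms xs) (λ τ τ∈ → trans (uniform τ) (|τ|≡|xs| τ∈)) ⟩
    ∑[ τ ∈ perms xs ] (suc (length xs) * g τ)     ≡⟨ ∑-*ˡ (perms xs) (suc (length xs)) g ⟩
    suc (length xs) * ∑ (perms xs) g              ∎
    where
    |τ|≡|xs| : {τ : List A} → τ ∈ perms xs → suc (length τ) * g τ ≡ suc (length xs) * g τ
    |τ|≡|xs| {τ} τ∈ = cong (λ l → suc l * g τ) (↭.↭-length (∈-perms⇒↭ xs τ∈))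

  length-perms-∷ : (x : A) (xs : List A) → length (perms (x ∷ xs)) ≡ suc (length xs) * length (perms xs)
  length-perms-∷ x xs = begin
    length (perms (x ∷ xs))                  ≡⟨ length≡∑1 (perms (x ∷ xs)) ⟩
    ∑[ σ ∈ perms (x ∷ xs) ] 1                ≡⟨ ∑-perms-∷-uniform x xs (λ _ → 1) insert-1 ⟩
    suc (length xs) * ∑[ σ ∈ perms xs ] 1    ≡⟨ cong (suc (length xs) *_) (length≡∑1 (perms xs)) ⟨
    suc (length xs) * length (perms xs)      ∎
    where
    insert-1 : ∀ τ → ∑[ σ ∈ insertAll x τ ] 1 ≡ suc (length τ) * 1
    insert-1 τ = trans (∑-const (insertAll x τ) 1) (cong (_* 1) (length-insertAll x τ))

-- First occurrences

module _ {A : Set} (_≟_ : DecidableEquality A) where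

  firstIs : (A → Bool) → A → List A → Bool
  firstIs p e [] = false
  firstIs p e (x ∷ σ) = if p x then ⌊ x ≟ e ⌋ else firstIs p e σ

  ∑-insertAll-firstIs-skip : (p : A → Bool) (e : A) {x : A} → p x ≡ false → (τ : List A) →
    ∑[ σ ∈ insertAll x τ ] ⟦ firstIs p e σ ⟧ ≡ suc (length τ) * ⟦ firstIs p e τ ⟧
  ∑-insertAll-firstIs-skip p e px [] rewrite px = refl
  ∑-insertAll-firstIs-skip p e {x} px (y ∷ ys) rewrite px
    | ∑-map (y ∷_) (insertAll x ys) (λ σ → ⟦ firstIs p e σ ⟧) with p y
  ... | true = cong (⟦ ⌊ y ≟ e ⌋ ⟧ +_)
                 (trans (∑-const (insertAll x ys) _) (cong (_* ⟦ ⌊ y ≟ e ⌋ ⟧) (length-insertAll x ys)))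
  ... | false = cong (⟦ firstIs p e ys ⟧ +_) (∑-insertAll-firstIs-skip p e px ys)

  ∑-insertAll-firstIs-head : (p : A → Bool) {e : A} → p e ≡ true → (τ : List A) →
    All (λ y → p y ≡ true × y ≢ e) τ → ∑[ σ ∈ insertAll e τ ] ⟦ firstIs p e σ ⟧ ≡ 1
  ∑-insertAll-firstIs-head p {e} pe [] [] rewrite pe | ⌊≟⌋-refl _≟_ e = refl
  ∑-insertAll-firstIs-head p {e} pe (y ∷ ys) ((py , y≢e) ∷ _) rewrite pe | ⌊≟⌋-refl _≟_ e
    | ∑-map (y ∷_) (insertAll e (ys)) (λ σ → ⟦ firstIs p e σ ⟧) =
    cong suc (∑-zero (insertAll e ys) (λ σ _ → not-first σ))
    where
    not-first : (σ : List A) → ⟦ firstIs p e (y ∷ σ) ⟧ ≡ 0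
    not-first σ rewrite py | ⌊≟⌋-≢ _≟_ y≢e = refl

  partition-↭ : (p : A → Bool) (L : List A) →
    ∃₂ λ R M → L ↭ R ++ M × All (λ r → p r ≡ false) R × All (λ m → p m ≡ true) M
  partition-↭ p [] = [] , [] , ↭-refl , [] , []
  partition-↭ p (x ∷ xs) with partition-↭ p xs | p x in px
  ... | R , M , xs↭ , pR , pM | true  = R , x ∷ M , ↭-trans (prep x xs↭) (↭-sym (↭.shift x R M)) , pR , px ∷ pM
  ... | R , M , xs↭ , pR , pM | false = x ∷ R , M , prep x xs↭ , px ∷ pR , pM

  module _ (p : A → Bool) (e : A) where

    firsts : List A → ℕ
    firsts L = ∑[ σ ∈ perms L ] ⟦ firstIs p e σ ⟧

    firsts-∷-head : p e ≡ true → (B : List A) → All (λ y → p y ≡ true × y ≢ e) B →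
      suc (length B) * firsts (e ∷ B) ≡ length (perms (e ∷ B))
    firsts-∷-head pe B pB = begin
      suc (length B) * firsts (e ∷ B)
        ≡⟨ cong (suc (length B) *_) (∑-perms-∷ e B _) ⟩
      suc (length B) * ∑[ τ ∈ perms B ] ∑[ σ ∈ insertAll e τ ] ⟦ firstIs p e σ ⟧
        ≡⟨ cong (suc (length B) *_) (∑-cong (perms B) (λ τ τ∈ →
             ∑-insertAll-firstIs-head p pe τ (↭.All-resp-↭ (↭-sym (∈-perms⇒↭ B τ∈)) pB))) ⟩
      suc (length B) * ∑[ τ ∈ perms B ] 1
        ≡⟨ cong (suc (length B) *_) (length≡∑1 (perms B)) ⟨
      suc (length B) * length (perms B)
        ≡⟨ length-perms-∷ e B ⟨
      length (perms (e ∷ B)) ∎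

    firsts-++-skipped : (k : ℕ) (Z : List A) → k * firsts Z ≡ length (perms Z) →
      (R : List A) → All (λ r → p r ≡ false) R → k * firsts (R ++ Z) ≡ length (perms (R ++ Z))
    firsts-++-skipped k Z eq [] [] = eq
    firsts-++-skipped k Z eq (r ∷ R) (pr ∷ pR) = begin
      k * firsts (r ∷ R ++ Z)
        ≡⟨ cong (k *_) (∑-perms-∷-uniform r (R ++ Z) _ (∑-insertAll-firstIs-skip p e pr)) ⟩
      k * (suc (length (R ++ Z)) * firsts (R ++ Z))
        ≡⟨ x*[y*z]≡y*[x*z] k (suc (length (R ++ Z))) _ ⟩
      suc (length (R ++ Z)) * (k * firsts (R ++ Z))
        ≡⟨ cong (suc (length (R ++ Z)) *_) (firsts-++-skipped k Z eq R pR) ⟩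
      suc (length (R ++ Z)) * length (perms (R ++ Z))
        ≡⟨ length-perms-∷ r (R ++ Z) ⟨
      length (perms (r ∷ R ++ Z)) ∎
      where
      x*[y*z]≡y*[x*z] : ∀ x y z → x * (y * z) ≡ y * (x * z)
      x*[y*z]≡y*[x*z] = solve-∀

    -- Elements outside p can sit anywhere without changing which element of p comes first, so
    -- only the relative order of the elements of p matters, and e heads it in 1/count of the cases.
    count*firsts≡|perms| : p e ≡ true → (L : List A) → Unique L → e ∈ L →
      ∑[ x ∈ L ] ⟦ p x ⟧ * firsts L ≡ length (perms L)
    count*firsts≡|perms| pe L uniq e∈L with partition-↭ p L
    ... | R , M , L↭ , pR , pM with ∈-++⁻ R (↭.∈-resp-↭ L↭ e∈L)
    ...   | inj₁ e∈R with () ← trans (sym pe) (All.lookup pR e∈R)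
    ...   | inj₂ e∈M with ∈-∃++ e∈M
    ...     | M₁ , M₂ , refl = begin
      ∑[ x ∈ L ] ⟦ p x ⟧ * firsts L             ≡⟨ cong₂ _*_ count (∑-perms-↭ L↭′ _) ⟩
      suc (length B) * firsts (R ++ e ∷ B)      ≡⟨ firsts-++-skipped (suc (length B)) (e ∷ B) (firsts-∷-head pe B pB) R pR ⟩
      length (perms (R ++ e ∷ B))               ≡⟨ length-perms-↭ L↭′ ⟨
      length (perms L)                          ∎
      where
      B = M₁ ++ M₂
      L↭′ : L ↭ R ++ e ∷ B
      L↭′ = ↭-trans L↭ (↭.++⁺ˡ R (↭.shift e M₁ M₂))
      pB′ : All (λ y → p y ≡ true) B
      pB′ with All.++⁻ M₁ pM
      ... | pM₁ , _ ∷ pM₂ = All.++⁺ pM₁ pM₂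
      count : ∑[ x ∈ L ] ⟦ p x ⟧ ≡ suc (length B)
      count = begin
        ∑[ x ∈ L ] ⟦ p x ⟧                          ≡⟨ trans (∑-↭ _ L↭′) (∑-++ R (e ∷ B) _) ⟩
        ∑[ x ∈ R ] ⟦ p x ⟧ + (⟦ p e ⟧ + ∑[ x ∈ B ] ⟦ p x ⟧)
          ≡⟨ cong₂ (λ a b → a + (⟦ b ⟧ + ∑[ x ∈ B ] ⟦ p x ⟧)) (∑-zero R (λ r r∈ → cong ⟦_⟧ (All.lookup pR r∈))) pe ⟩
        suc (∑[ x ∈ B ] ⟦ p x ⟧)
          ≡⟨ cong suc (∑-cong B (λ b b∈ → cong ⟦_⟧ (All.lookup pB′ b∈))) ⟩
        suc (∑[ x ∈ B ] 1)                          ≡⟨ cong suc (length≡∑1 B) ⟨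
        suc (length B)                              ∎
      e∉B : All (_≢ e) B
      e∉B with Unique-resp-↭ (↭-trans L↭′ (↭.shift e R B)) uniq
      ... | e∉RB ∷ _ = All.map (λ e≢y y≡e → e≢y (sym y≡e)) (All.++⁻ʳ R e∉RB)
      pB : All (λ y → p y ≡ true × y ≢ e) B
      pB = All.zip (pB′ , e∉B)

-- Connectivity

module _ {n : ℕ} where

  Closed : List (Edge n) → (Fin n → Bool) → Set
  Closed F R = All (λ e → R (proj₁ e) ≡ R (proj₂ e)) F

  -- y lies in every union of components that contains x
  Connected : List (Edge n) → Fin n → Fin n → Set
  Connected F x y = (R : Fin n → Bool) → Closed F R → T (R x) → T (R y)

  Connected-refl : (F : List (Edge n)) (x : Fin n) → Connected F x x
  Connected-refl F x R closed Rx = Rx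

  Connected-trans : {F : List (Edge n)} {x y z : Fin n} → Connected F x y → Connected F y z → Connected F x z
  Connected-trans x~y y~z R closed = y~z R closed ∘ x~y R closed

  Connected-sym : {F : List (Edge n)} {x y : Fin n} → Connected F x y → Connected F y x
  Connected-sym {x = x} {y} x~y R closed Ry with R x in Rx
  ... | true = tt
  ... | false = ⊥-elim (subst T Ry≡false Ry)
    where
    Ry≡false : R y ≡ false
    Ry≡false = Equivalence.to T-not-≡ (x~y (not ∘ R) (All.map (cong not) closed) (Equivalence.from T-not-≡ Rx))

  Connected-edge : {F : List (Edge n)} {a b : Fin n} → (a , b) ∈ F → Connected F a b
  Connected-edge ab∈ R closed = subst T (All.lookup closed ab∈)

  extends-along : (S : Fin n → Bool) (x a b : Fin n) → T ((S a ∧ (x == b)) ∨ (S b ∧ (x == a))) →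
    (T (S a) × x ≡ b) ⊎ (T (S b) × x ≡ a)
  extends-along S x a b t with Equivalence.to T-∨ t
  ... | inj₁ t′ = let Sa , x==b = Equivalence.to T-∧ t′ in inj₁ (Sa , T-== x==b)
  ... | inj₂ t′ = let Sb , x==a = Equivalence.to T-∧ t′ in inj₂ (Sb , T-== x==a)

  iter⇒Connected : (F : List (Edge n)) (v : Fin n) (k : ℕ) {x : Fin n} →
    T (iter k F (_== v) x) → Connected F v x
  iter⇒Connected F v zero x==v rewrite T-== x==v = Connected-refl F v
  iter⇒Connected F v (suc k) {x} h with Equivalence.to T-∨ h
  ... | inj₁ h′ = iter⇒Connected F v k h′
  ... | inj₂ h′ with find (any⁻ _ F h′)
  ...   | (a , b) , ab∈ , t with extends-along (iter k F (_== v)) x a b t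
  ...     | inj₁ (Sa , refl) = Connected-trans (iter⇒Connected F v k Sa) (Connected-edge ab∈)
  ...     | inj₂ (Sb , refl) = Connected-trans (iter⇒Connected F v k Sb) (Connected-sym (Connected-edge ab∈))

  along-edge : (S : Fin n → Bool) (x a b : Fin n) → (T (S a) × x ≡ b) ⊎ (T (S b) × x ≡ a) →
    T ((S a ∧ (x == b)) ∨ (S b ∧ (x == a)))
  along-edge S x a b (inj₁ (Sa , refl)) = Equivalence.from T-∨ (inj₁ (Equivalence.from T-∧ (Sa , T-==-refl b)))
  along-edge S x a b (inj₂ (Sb , refl)) = Equivalence.from T-∨ (inj₂ (Equivalence.from T-∧ (Sb , T-==-refl a)))

  step-⊇ : (F : List (Edge n)) (S : Fin n → Bool) (x : Fin n) → T (S x) → T (step F S x)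
  step-⊇ F S x = Equivalence.from T-∨ ∘ inj₁

  step-mono : (F : List (Edge n)) {S S′ : Fin n → Bool} → (∀ x → T (S x) → T (S′ x)) →
    ∀ x → T (step F S x) → T (step F S′ x)
  step-mono F {S} {S′} S⊆S′ x t with Equivalence.to T-∨ t
  ... | inj₁ Sx = step-⊇ F S′ x (S⊆S′ x Sx)
  ... | inj₂ t′ = Equivalence.from T-∨ (inj₂ (any⁺ _ (Any.map (λ {(a , b)} → mono a b) (any⁻ _ F t′))))
    where
    mono : ∀ a b → T ((S a ∧ (x == b)) ∨ (S b ∧ (x == a))) → T ((S′ a ∧ (x == b)) ∨ (S′ b ∧ (x == a)))
    mono a b t with extends-along S x a b t
    ... | inj₁ (Sa , x≡b) = along-edge S′ x a b (inj₁ (S⊆S′ a Sa , x≡b))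
    ... | inj₂ (Sb , x≡a) = along-edge S′ x a b (inj₂ (S⊆S′ b Sb , x≡a))

  Stable : List (Edge n) → (Fin n → Bool) → Set
  Stable F S = ∀ x → T (step F S x) → T (S x)

  Stable⇒Closed : (F : List (Edge n)) (S : Fin n → Bool) → Stable F S → Closed F S
  Stable⇒Closed F S stable = All.tabulate λ {(a , b)} ab∈ → T-ext
    (λ Sa → stable b (reach-by ab∈ (along-edge S b a b (inj₁ (Sa , refl)))))
    (λ Sb → stable a (reach-by ab∈ (along-edge S a a b (inj₂ (Sb , refl)))))
    where
    reach-by : ∀ {a b x} → (a , b) ∈ F → T ((S a ∧ (x == b)) ∨ (S b ∧ (x == a))) → T (step F S x)
    reach-by ab∈ t = Equivalence.from T-∨ (inj₂ (any⁺ _ (Any.map (λ { refl → t }) ab∈)))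

  size : (Fin n → Bool) → ℕ
  size S = ∑[ x ∈ allFin n ] ⟦ S x ⟧

  size≤n : (S : Fin n → Bool) → size S ≤ n
  size≤n S = ≤-trans (∑-mono-≤ (allFin n) (λ x → ⟦⟧≤1 (S x)))
    (≤-reflexive (trans (sym (length≡∑1 (allFin n))) (length-allFin n)))

  size-< : {S S′ : Fin n → Bool} {y : Fin n} → (∀ x → T (S x) → T (S′ x)) → T (S′ y) → ¬ T (S y) →
    size S < size S′
  size-< {S} {S′} {y} S⊆S′ S′y ¬Sy = ∑-mono-< (allFin n) (λ x → ⟦⟧-mono (S⊆S′ x)) (∈-allFin y) Sy<S′y
    where
    Sy<S′y : ⟦ S y ⟧ < ⟦ S′ y ⟧
    Sy<S′y with S y | S′ y
    ... | false | true = s≤s z≤n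
    ... | true | _ = ⊥-elim (¬Sy tt)
    ... | false | false = ⊥-elim S′y

  module _ (F : List (Edge n)) (v : Fin n) where

    iter-∋ : ∀ k → T (iter k F (_== v) v)
    iter-∋ zero = T-==-refl v
    iter-∋ (suc k) = step-⊇ F (iter k F (_== v)) v (iter-∋ k)

    iter-stable-or-grows : ∀ k → Stable F (iter k F (_== v)) ⊎ k < size (iter k F (_== v))
    iter-stable-or-grows zero = inj₂ (subst (_< size (_== v)) (∑-zero (allFin n) (λ _ _ → refl))
      (size-< {S = λ _ → false} (λ _ ()) (iter-∋ zero) (λ ())))
    iter-stable-or-grows (suc k) with any? (λ x → T? (step F S x) ×-dec ¬? (T? (S x)))
      where S = iter k F (_== v)
    ... | yes (y , Sy′ , ¬Sy) with iter-stable-or-grows k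
    ...   | inj₁ stable = ⊥-elim (¬Sy (stable y Sy′))
    ...   | inj₂ k<size = inj₂ (≤-trans (s≤s k<size) (size-< (step-⊇ F _) Sy′ ¬Sy))
    iter-stable-or-grows (suc k) | no ¬grows = inj₁ λ x t → step-⊇ F S x (stable x (step-mono F stable x t))
      where
      S = iter k F (_== v)
      stable : Stable F S
      stable x t with T? (S x)
      ... | yes Sx = Sx
      ... | no ¬Sx = ⊥-elim (¬grows (x , t , ¬Sx))

    reachable-closed : Closed F (reachable F v)
    reachable-closed with iter-stable-or-grows n
    ... | inj₁ stable = Stable⇒Closed F _ stable
    ... | inj₂ n<size = ⊥-elim (<⇒≱ n<size (size≤n _))

  reachable⇒Connected : {F : List (Edge n)} {v x : Fin n} → T (reachable F v x) → Connected F v x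
  reachable⇒Connected {F} {v} = iter⇒Connected F v n

  Connected⇒reachable : {F : List (Edge n)} {v x : Fin n} → Connected F v x → T (reachable F v x)
  Connected⇒reachable {F} {v} v~x = v~x (reachable F v) (reachable-closed F v) (iter-∋ F v n)

-- Components

module _ {A : Set} where

  length-filter-T? : (p : A → Bool) (xs : List A) → length (filter (λ x → T? (p x)) xs) ≡ ∑[ x ∈ xs ] ⟦ p x ⟧
  length-filter-T? p [] = refl
  length-filter-T? p (x ∷ xs) with p x
  ... | true = cong suc (length-filter-T? p xs)
  ... | false = length-filter-T? p xs

module _ {n : ℕ} where

  isRep-intro : (F : List (Edge n)) (x : Fin n) → (∀ y → toℕ y < toℕ x → ¬ Connected F x y) → T (isRep F x)
  isRep-intro F x least = T-not-intro λ t →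
    let y , _ , earlier = find (any⁻ _ (allFin n) t)
        y<x , x~y = Equivalence.to T-∧ earlier
    in least y (<ᵇ⇒< _ _ y<x) (reachable⇒Connected x~y)

  isRep-elim : {F : List (Edge n)} {x y : Fin n} → T (isRep F x) → toℕ y < toℕ x → ¬ Connected F x y
  isRep-elim {y = y} rep y<x x~y = T-not-elim rep
    (any⁺ _ (Any.map (λ { refl → Equivalence.from T-∧ (<⇒<ᵇ y<x , Connected⇒reachable x~y) }) (∈-allFin y)))

  ¬isRep-elim : {F : List (Edge n)} {x : Fin n} → ¬ T (isRep F x) → ∃ λ y → toℕ y < toℕ x × Connected F x y
  ¬isRep-elim ¬rep =
    let y , _ , earlier = find (any⁻ _ (allFin n) (¬T-not-elim ¬rep))
        y<x , x~y = Equivalence.to T-∧ earlier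
    in y , <ᵇ⇒< _ _ y<x , reachable⇒Connected x~y

  rep-exists : (F : List (Edge n)) (x : Fin n) → ∃ λ r → Connected F x r × T (isRep F r)
  rep-exists F x = descend n x (toℕ<n x)
    where
    descend : (k : ℕ) (x : Fin n) → toℕ x < k → ∃ λ r → Connected F x r × T (isRep F r)
    descend (suc k) x x<k with T? (isRep F x)
    ... | yes rep = x , Connected-refl F x , rep
    ... | no ¬rep with y , y<x , x~y ← ¬isRep-elim ¬rep with r , y~r , rep ← descend k y (≤-trans y<x (≤-pred x<k)) =
      r , Connected-trans x~y y~r , rep

  components≡∑isRep : (F : List (Edge n)) → components F ≡ ∑[ x ∈ allFin n ] ⟦ isRep F x ⟧
  components≡∑isRep F = length-filter-T? (isRep F) (allFin n)

  components-cong : {F G : List (Edge n)} → (∀ R → Closed F R → Closed G R) → (∀ R → Closed G R → Closed F R) →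
    components F ≡ components G
  components-cong {F} {G} F⇒G G⇒F = begin
    components F                           ≡⟨ components≡∑isRep F ⟩
    ∑[ x ∈ allFin n ] ⟦ isRep F x ⟧
      ≡⟨ ∑-cong (allFin n) (λ x _ → cong ⟦_⟧ (T-ext (transfer F⇒G) (transfer G⇒F))) ⟩
    ∑[ x ∈ allFin n ] ⟦ isRep G x ⟧        ≡⟨ components≡∑isRep G ⟨
    components G                           ∎
    where
    transfer : {F G : List (Edge n)} {x : Fin n} → (∀ R → Closed F R → Closed G R) → T (isRep F x) → T (isRep G x)
    transfer F⇒G rep = isRep-intro _ _ λ y y<x x~y → isRep-elim rep y<x (λ R closed → x~y R (F⇒G R closed))

  components-↭ : {F G : List (Edge n)} → F ↭ G → components F ≡ components G
  components-↭ F↭G = components-cong (λ R → ↭.All-resp-↭ F↭G) (λ R → ↭.All-resp-↭ (↭-sym F↭G))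

  components-flip : (F : List (Edge n)) (u v : Fin n) → components ((u , v) ∷ F) ≡ components ((v , u) ∷ F)
  components-flip F u v = components-cong flip flip
    where
    flip : ∀ {a b} R → Closed ((a , b) ∷ F) R → Closed ((b , a) ∷ F) R
    flip R (Ra≡Rb ∷ closed) = sym Ra≡Rb ∷ closed

  isRep-least : {F : List (Edge n)} {x y : Fin n} → T (isRep F x) → Connected F x y → toℕ x ≤ toℕ y
  isRep-least rep x~y = ≮⇒≥ (λ y<x → isRep-elim rep y<x x~y)

  isRep-unique : {F : List (Edge n)} {x y : Fin n} → T (isRep F x) → T (isRep F y) → Connected F x y → x ≡ y
  isRep-unique rep-x rep-y x~y =
    toℕ-injective (≤-antisym (isRep-least rep-x x~y) (isRep-least rep-y (Connected-sym x~y)))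

  Isolated : List (Edge n) → Fin n → Set
  Isolated F a = All (λ e → proj₁ e ≢ a × proj₂ e ≢ a) F

  module Attach (F : List (Edge n)) {a b : Fin n} (a≢b : a ≢ b) (isolated : Isolated F a) where

    F′ : List (Edge n)
    F′ = (a , b) ∷ F

    Connected-isolated : {x : Fin n} → Connected F a x → x ≡ a
    Connected-isolated a~x = T-== (a~x (_== a) closed (T-==-refl a))
      where
      closed : Closed F (_== a)
      closed = All.map (λ (p≢a , q≢a) → trans (⌊≟⌋-≢ _≟_ p≢a) (sym (⌊≟⌋-≢ _≟_ q≢a))) isolated

    Connected-F′ : {x y : Fin n} → Connected F x y → Connected F′ x y
    Connected-F′ x~y R (_ ∷ closed) = x~y R closed

    Joined : Fin n → Set
    Joined z = z ≡ a ⊎ Connected F b z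

    attach⇐ : {x y : Fin n} → Joined x → Joined y → Connected F′ x y
    attach⇐ Jx Jy = Connected-trans (to-a Jx) (Connected-sym (to-a Jy))
      where
      to-a : {z : Fin n} → Joined z → Connected F′ z a
      to-a (inj₁ refl) = Connected-refl F′ a
      to-a (inj₂ b~z) = Connected-sym (Connected-trans (λ R → λ { (Ra≡Rb ∷ _) → subst T Ra≡Rb }) (Connected-F′ b~z))

    joined : Fin n → Bool
    joined z = (z == a) ∨ reachable F b z

    joined⇒Joined : {z : Fin n} → T (joined z) → Joined z
    joined⇒Joined t with Equivalence.to T-∨ t
    ... | inj₁ z==a = inj₁ (T-== z==a)
    ... | inj₂ b~z = inj₂ (reachable⇒Connected b~z)

    Joined⇒joined : {z : Fin n} → Joined z → T (joined z)
    Joined⇒joined (inj₁ refl) = Equivalence.from T-∨ (inj₁ (T-==-refl a))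
    Joined⇒joined (inj₂ b~z) = Equivalence.from T-∨ (inj₂ (Connected⇒reachable b~z))

    attach⇒ : {x y : Fin n} → Connected F′ x y → Connected F x y ⊎ (Joined x × Joined y)
    -- R marks the F-component of x, enlarged by the joined component when x belongs to it.
    attach⇒ {x} {y} x~y with Equivalence.to T-∨ (x~y R closed (T-∨ˡ _ (Connected⇒reachable (Connected-refl F x))))
      where
      R : Fin n → Bool
      R z = reachable F x z ∨ (joined x ∧ joined z)
      Joined-resp : {p q : Fin n} → Connected F p q → Joined p → Joined q
      Joined-resp p~q (inj₁ refl) = inj₁ (Connected-isolated p~q)
      Joined-resp p~q (inj₂ b~p) = inj₂ (Connected-trans b~p p~q)
      R-resp : {p q : Fin n} → Connected F p q → T (R p) → T (R q)
      R-resp p~q Rp with Equivalence.to T-∨ Rp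
      ... | inj₁ x~p = Equivalence.from T-∨ (inj₁ (Connected⇒reachable (Connected-trans (reachable⇒Connected x~p) p~q)))
      ... | inj₂ Jxp with Jx , Jp ← Equivalence.to T-∧ Jxp =
        Equivalence.from T-∨ (inj₂ (Equivalence.from T-∧ (Jx , Joined⇒joined (Joined-resp p~q (joined⇒Joined Jp)))))
      via-Joined : {p : Fin n} → Joined x → Joined p → T (R p)
      via-Joined Jx Jp = Equivalence.from T-∨ (inj₂ (Equivalence.from T-∧ (Joined⇒joined Jx , Joined⇒joined Jp)))
      a→b : T (R a) → T (R b)
      a→b Ra with Equivalence.to T-∨ Ra
      ... | inj₁ x~a =
        via-Joined (inj₁ (Connected-isolated (Connected-sym (reachable⇒Connected x~a)))) (inj₂ (Connected-refl F b))
      ... | inj₂ Jxa = via-Joined (joined⇒Joined (proj₁ (Equivalence.to T-∧ Jxa))) (inj₂ (Connected-refl F b))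
      b→a : T (R b) → T (R a)
      b→a Rb with Equivalence.to T-∨ Rb
      ... | inj₁ x~b = via-Joined (inj₂ (Connected-sym (reachable⇒Connected x~b))) (inj₁ refl)
      ... | inj₂ Jxb = via-Joined (joined⇒Joined (proj₁ (Equivalence.to T-∧ Jxb))) (inj₁ refl)
      closed : Closed F′ R
      closed = T-ext a→b b→a ∷
        All.tabulate (λ pq∈ → T-ext (R-resp (Connected-edge pq∈)) (R-resp (Connected-sym (Connected-edge pq∈))))
    ... | inj₁ x~y = inj₁ (reachable⇒Connected x~y)
    ... | inj₂ Jxy = let Jx , Jy = Equivalence.to T-∧ Jxy in inj₂ (joined⇒Joined Jx , joined⇒Joined Jy)

    isRep-F′⇒F : {w : Fin n} → T (isRep F′ w) → T (isRep F w)
    isRep-F′⇒F rep = isRep-intro F _ λ y y<w w~y → isRep-elim rep y<w (Connected-F′ w~y)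

    isRep-outside : {w : Fin n} → ¬ Joined w → T (isRep F w) → T (isRep F′ w)
    isRep-outside ¬Jw rep = isRep-intro F′ _ λ y y<w w~y → case attach⇒ w~y of λ where
      (inj₁ w~y) → isRep-elim rep y<w w~y
      (inj₂ (Jw , _)) → ¬Jw Jw

    isRep-a : T (isRep F a)
    isRep-a = isRep-intro F a λ y y<a a~y → <-irrefl (cong toℕ (Connected-isolated a~y)) y<a

    Joined? : (w : Fin n) → Dec (Joined w)
    Joined? w = (w ≟ a) ⊎-dec Dec.map′ reachable⇒Connected Connected⇒reachable (T? (reachable F b w))

    -- The vertex that stops representing is the larger of a and the representative c of b's component.
    lost-rep : ∃ λ m → T (isRep F m) × ¬ T (isRep F′ m) × (∀ w → w ≢ m → isRep F w ≡ isRep F′ w)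
    lost-rep with c , b~c , rep-c ← rep-exists F b with <-cmp (toℕ a) (toℕ c)
    ... | tri≈ _ a≡c _ with refl ← toℕ-injective {i = a} {c} a≡c = ⊥-elim (a≢b (sym (Connected-isolated (Connected-sym b~c))))
    ... | tri< a<c _ _ = c , rep-c , (λ rep′ → isRep-elim rep′ a<c (attach⇐ (inj₂ b~c) (inj₁ refl))) ,
      λ w w≢c → T-ext (keep w w≢c) isRep-F′⇒F
      where
      keep : ∀ w → w ≢ c → T (isRep F w) → T (isRep F′ w)
      keep w w≢c rep with Joined? w
      ... | no ¬Jw = isRep-outside ¬Jw rep
      ... | yes (inj₂ b~w) = ⊥-elim (w≢c (isRep-unique rep rep-c (Connected-trans (Connected-sym b~w) b~c)))
      ... | yes (inj₁ refl) = isRep-intro F′ a λ y y<a a~y → case attach⇒ a~y of λ where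
        (inj₁ a~y) → <-irrefl (cong toℕ (Connected-isolated a~y)) y<a
        (inj₂ (_ , inj₁ refl)) → <-irrefl refl y<a
        (inj₂ (_ , inj₂ b~y)) →
          <-irrefl refl (<-trans y<a (<-≤-trans a<c (isRep-least rep-c (Connected-trans (Connected-sym b~c) b~y))))
    ... | tri> _ _ c<a = a , isRep-a , (λ rep′ → isRep-elim rep′ c<a (attach⇐ (inj₁ refl) (inj₂ b~c))) ,
      λ w w≢a → T-ext (keep w w≢a) isRep-F′⇒F
      where
      keep : ∀ w → w ≢ a → T (isRep F w) → T (isRep F′ w)
      keep w w≢a rep with Joined? w
      ... | no ¬Jw = isRep-outside ¬Jw rep
      ... | yes (inj₁ w≡a) = ⊥-elim (w≢a w≡a)
      ... | yes (inj₂ b~w) rewrite isRep-unique rep rep-c (Connected-trans (Connected-sym b~w) b~c) =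
        isRep-intro F′ c λ y y<c c~y → case attach⇒ c~y of λ where
          (inj₁ c~y) → isRep-elim rep-c y<c c~y
          (inj₂ (_ , inj₁ refl)) → <-asym c<a y<c
          (inj₂ (_ , inj₂ b~y)) → isRep-elim rep-c y<c (Connected-trans (Connected-sym b~c) b~y)

    components-attach : components F ≡ suc (components F′)
    components-attach with m , rep , ¬rep′ , same ← lost-rep = begin
      components F                                             ≡⟨ components≡∑isRep F ⟩
      ∑[ w ∈ allFin n ] ⟦ isRep F w ⟧                          ≡⟨ ∑-cong (allFin n) (λ w _ → split w) ⟩
      ∑[ w ∈ allFin n ] (⟦ w == m ⟧ + ⟦ isRep F′ w ⟧)          ≡⟨ ∑-+ (allFin n) _ _ ⟩
      ∑[ w ∈ allFin n ] ⟦ w == m ⟧ + ∑[ w ∈ allFin n ] ⟦ isRep F′ w ⟧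
        ≡⟨ cong₂ _+_ (∑-δ₁ _≟_ (Unique.allFin⁺ n) (∈-allFin m)) (sym (components≡∑isRep F′)) ⟩
      suc (components F′)                                      ∎
      where
      split : ∀ w → ⟦ isRep F w ⟧ ≡ ⟦ w == m ⟧ + ⟦ isRep F′ w ⟧
      split w with w ≟ m
      ... | yes refl rewrite Equivalence.to T-≡ rep | Equivalence.to T-not-≡ (T-not-intro ¬rep′) = refl
      ... | no w≢m = cong ⟦_⟧ (same w w≢m)

-- The forest building process

module _ {n : ℕ} where

  unseen : List (Fin n) → ℕ
  unseen seen = ∑[ w ∈ allFin n ] ⟦ not (elem w seen) ⟧

  seenAfter : List (Fin n) → List (Edge n) → List (Fin n)
  seenAfter seen [] = seen
  seenAfter seen ((u , v) ∷ σ) = seenAfter (u ∷ v ∷ seen) σ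

  fresh : List (Fin n) → Edge n → Bool
  fresh seen (a , b) = not (elem a seen ∨ elem b seen)

  bothNew : List (Fin n) → List (Edge n) → ℕ
  bothNew seen [] = 0
  bothNew seen ((u , v) ∷ σ) = ⟦ fresh seen (u , v) ⟧ + bothNew (u ∷ v ∷ seen) σ

  Spanned : List (Fin n) → List (Edge n) → Set
  Spanned seen F = All (λ e → T (elem (proj₁ e) seen) × T (elem (proj₂ e) seen)) F

  LoopFree : List (Edge n) → Set
  LoopFree σ = All (λ e → proj₁ e ≢ proj₂ e) σ

  Covers : List (Edge n) → Set
  Covers σ = (w : Fin n) → Any (λ e → w ≡ proj₁ e ⊎ w ≡ proj₂ e) σ

  elem-∷ˡ : (u v : Fin n) (seen : List (Fin n)) → T (elem u (u ∷ v ∷ seen))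
  elem-∷ˡ u v seen = T-∨ˡ (elem u (v ∷ seen)) (T-==-refl u)

  elem-∷ʳ : (u v : Fin n) (seen : List (Fin n)) → T (elem v (u ∷ v ∷ seen))
  elem-∷ʳ u v seen = T-∨ʳ (u == v) (T-∨ˡ (elem v seen) (T-==-refl v))

  elem-∷-mono : (u v : Fin n) {w : Fin n} (seen : List (Fin n)) → T (elem w seen) → T (elem w (u ∷ v ∷ seen))
  elem-∷-mono u v {w} seen w∈ = T-∨ʳ (u == w) (T-∨ʳ (v == w) w∈)

  Spanned-∷ : (u v : Fin n) (seen : List (Fin n)) {F : List (Edge n)} → Spanned seen F → Spanned (u ∷ v ∷ seen) F
  Spanned-∷ u v seen = All.map λ (p∈ , q∈) → elem-∷-mono u v seen p∈ , elem-∷-mono u v seen q∈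

  Spanned⇒Isolated : (seen : List (Fin n)) {F : List (Edge n)} {a : Fin n} → Spanned seen F → ¬ T (elem a seen) →
    Isolated F a
  Spanned⇒Isolated seen spanned a∉ = All.map (λ (p∈ , q∈) → (λ { refl → a∉ p∈ }) , (λ { refl → a∉ q∈ })) spanned

  unseen-∷ : (u v : Fin n) (seen : List (Fin n)) → u ≢ v →
    unseen seen ≡ unseen (u ∷ v ∷ seen) + (⟦ not (elem u seen) ⟧ + ⟦ not (elem v seen) ⟧)
  unseen-∷ u v seen u≢v = begin
    unseen seen
      ≡⟨ ∑-cong (allFin n) (λ w _ → split w) ⟩
    ∑[ w ∈ allFin n ] (⟦ not (elem w (u ∷ v ∷ seen)) ⟧ + (⟦ w == u ⟧ * new w + ⟦ w == v ⟧ * new w))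
      ≡⟨ trans (∑-+ (allFin n) _ _) (cong (unseen (u ∷ v ∷ seen) +_) (∑-+ (allFin n) _ _)) ⟩
    unseen (u ∷ v ∷ seen) + (∑[ w ∈ allFin n ] (⟦ w == u ⟧ * new w) + ∑[ w ∈ allFin n ] (⟦ w == v ⟧ * new w))
      ≡⟨ cong (λ k → unseen (u ∷ v ∷ seen) + k) (cong₂ _+_ (δ u) (δ v)) ⟩
    unseen (u ∷ v ∷ seen) + (new u + new v) ∎
    where
    new : Fin n → ℕ
    new w = ⟦ not (elem w seen) ⟧
    δ : (m : Fin n) → ∑[ w ∈ allFin n ] (⟦ w == m ⟧ * new w) ≡ new m
    δ m = ∑-δ _≟_ (Unique.allFin⁺ n) (∈-allFin m) new
    split : ∀ w → new w ≡ ⟦ not (elem w (u ∷ v ∷ seen)) ⟧ + (⟦ w == u ⟧ * new w + ⟦ w == v ⟧ * new w)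
    split w with w ≟ u | w ≟ v
    ... | yes refl | yes refl = ⊥-elim (u≢v refl)
    ... | yes refl | no w≢v rewrite ⌊≟⌋-refl _≟_ w = sym (trans (+-identityʳ _) (+-identityʳ _))
    ... | no w≢u | yes refl rewrite ⌊≟⌋-refl _≟_ w | ⌊≟⌋-≢ _≟_ (w≢u ∘ sym) = sym (+-identityʳ _)
    ... | no w≢u | no w≢v rewrite ⌊≟⌋-≢ _≟_ (w≢u ∘ sym) | ⌊≟⌋-≢ _≟_ (w≢v ∘ sym) =
      sym (+-identityʳ (new w))

  attach-invariant : {F B : List (Edge n)} {a b : Fin n} → a ≢ b → Isolated F a → {U D R : ℕ} (c : ℕ) →
    components (((a , b) ∷ F) ++ B) + U ≡ components ((a , b) ∷ F) + D + R →
    components ((a , b) ∷ F ++ B) + (U + (1 + c)) ≡ components F + (c + D) + R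
  attach-invariant {F} {B} {a} {b} a≢b isolated {U} {D} {R} c invariant = begin
    components ((a , b) ∷ F ++ B) + (U + (1 + c))   ≡⟨ +-assoc _ U (1 + c) ⟨
    components ((a , b) ∷ F ++ B) + U + (1 + c)     ≡⟨ cong (_+ (1 + c)) invariant ⟩
    components ((a , b) ∷ F) + D + R + (1 + c)      ≡⟨ regroup (components ((a , b) ∷ F)) D R c ⟩
    suc (components ((a , b) ∷ F)) + (c + D) + R
      ≡⟨ cong (λ k → k + (c + D) + R) (Attach.components-attach F a≢b isolated) ⟨
    components F + (c + D) + R                      ∎
    where
    regroup : ∀ k d r c → k + d + r + (1 + c) ≡ suc k + (c + d) + r
    regroup = solve-∀

  process-invariant : (σ : List (Edge n)) (seen : List (Fin n)) (F : List (Edge n)) → Spanned seen F → LoopFree σ →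
    components (F ++ buildFrom seen σ) + unseen seen ≡ components F + bothNew seen σ + unseen (seenAfter seen σ)
  process-invariant [] seen F _ _ rewrite ++-identityʳ F = cong (_+ unseen seen) (sym (+-identityʳ _))
  process-invariant ((u , v) ∷ σ) seen F spanned (u≢v ∷ loopFree)
    with elem u seen in u∈ | elem v seen in v∈ | unseen-∷ u v seen u≢v
  ... | true | true | unseen-seen = trans (cong (components (F ++ B′) +_) (trans unseen-seen (+-identityʳ _)))
    (process-invariant σ seen′ F (Spanned-∷ u v seen spanned) loopFree)
    where
    seen′ = u ∷ v ∷ seen
    B′ = buildFrom seen′ σ
  ... | false | v-seen | unseen-seen = begin
    components (F ++ (u , v) ∷ B′) + unseen seen
      ≡⟨ cong₂ _+_ (components-↭ (↭.shift (u , v) F B′)) unseen-seen ⟩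
    components ((u , v) ∷ F ++ B′) + (unseen seen′ + (1 + ⟦ not v-seen ⟧))
      ≡⟨ attach-invariant u≢v (Spanned⇒Isolated seen spanned (subst T u∈)) ⟦ not v-seen ⟧
           (process-invariant σ seen′ ((u , v) ∷ F)
             ((elem-∷ˡ u v seen , elem-∷ʳ u v seen) ∷ Spanned-∷ u v seen spanned) loopFree) ⟩
    components F + (⟦ not v-seen ⟧ + bothNew seen′ σ) + unseen (seenAfter seen′ σ) ∎
    where
    seen′ = u ∷ v ∷ seen
    B′ = buildFrom seen′ σ
  ... | true | false | unseen-seen = begin
    components (F ++ (u , v) ∷ B′) + unseen seen
      ≡⟨ cong₂ _+_ (trans (components-↭ (↭.shift (u , v) F B′)) (components-flip (F ++ B′) u v)) unseen-seen ⟩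
    components ((v , u) ∷ F ++ B′) + (unseen seen′ + 1)
      ≡⟨ attach-invariant (u≢v ∘ sym) (Spanned⇒Isolated seen spanned (subst T v∈)) 0
           (process-invariant σ seen′ ((v , u) ∷ F)
             ((elem-∷ʳ u v seen , elem-∷ˡ u v seen) ∷ Spanned-∷ u v seen spanned) loopFree) ⟩
    components F + bothNew seen′ σ + unseen (seenAfter seen′ σ) ∎
    where
    seen′ = u ∷ v ∷ seen
    B′ = buildFrom seen′ σ

  components-[] : components {n} [] ≡ n
  components-[] = begin
    components {n} []                 ≡⟨ components≡∑isRep {n} [] ⟩
    ∑[ x ∈ allFin n ] ⟦ isRep [] x ⟧   ≡⟨ ∑-cong (allFin n) (λ x _ → cong ⟦_⟧ (Equivalence.to T-≡ (alone x))) ⟩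
    ∑[ x ∈ allFin n ] 1                ≡⟨ length≡∑1 (allFin n) ⟨
    length (allFin n)                  ≡⟨ length-allFin n ⟩
    n                                  ∎
    where
    alone : (x : Fin n) → T (isRep [] x)
    alone x = isRep-intro [] x λ y y<x x~y → <-irrefl (cong toℕ (T-== (x~y (_== x) [] (T-==-refl x)))) y<x

  unseen-[] : unseen [] ≡ n
  unseen-[] = trans (sym (length≡∑1 (allFin n))) (length-allFin n)

  seenAfter-mono : (σ : List (Edge n)) (seen : List (Fin n)) {w : Fin n} →
    T (elem w seen) → T (elem w (seenAfter seen σ))
  seenAfter-mono [] seen w∈ = w∈
  seenAfter-mono ((u , v) ∷ σ) seen w∈ = seenAfter-mono σ (u ∷ v ∷ seen) (elem-∷-mono u v seen w∈)

  seenAfter-∋ : (σ : List (Edge n)) (seen : List (Fin n)) {w : Fin n} →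
    Any (λ e → w ≡ proj₁ e ⊎ w ≡ proj₂ e) σ → T (elem w (seenAfter seen σ))
  seenAfter-∋ ((u , v) ∷ σ) seen (here (inj₁ refl)) = seenAfter-mono σ (u ∷ v ∷ seen) (elem-∷ˡ u v seen)
  seenAfter-∋ ((u , v) ∷ σ) seen (here (inj₂ refl)) = seenAfter-mono σ (u ∷ v ∷ seen) (elem-∷ʳ u v seen)
  seenAfter-∋ ((u , v) ∷ σ) seen (there w∈) = seenAfter-∋ σ (u ∷ v ∷ seen) w∈

  components-forestOf : (σ : List (Edge n)) → LoopFree σ → Covers σ → components (forestOf σ) ≡ bothNew [] σ
  components-forestOf σ loopFree covers = +-cancelʳ-≡ n _ _ (begin
    components (forestOf σ) + n                         ≡⟨ cong (components (forestOf σ) +_) unseen-[] ⟨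
    components ([] ++ forestOf σ) + unseen []           ≡⟨ process-invariant σ [] [] [] loopFree ⟩
    components {n} [] + bothNew [] σ + unseen (seenAfter [] σ)
      ≡⟨ cong₂ (λ c r → c + bothNew [] σ + r) components-[] all-seen ⟩
    n + bothNew [] σ + 0                                ≡⟨ trans (+-identityʳ _) (+-comm n _) ⟩
    bothNew [] σ + n                                    ∎)
    where
    all-seen : unseen (seenAfter [] σ) ≡ 0
    all-seen = ∑-zero (allFin n) λ w _ → cong (⟦_⟧ ∘ not) (Equivalence.to T-≡ (seenAfter-∋ σ [] (covers w)))

-- Edges that come before all edges they touch

module _ {n : ℕ} where

  _≟ₑ_ : DecidableEquality (Edge n)
  _≟ₑ_ = ≡-dec _≟_ _≟_

  touches : Edge n → Edge n → Bool
  touches (a , b) (c , d) = ((c == a) ∨ (c == b)) ∨ ((d == a) ∨ (d == b))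

  touches-refl : (e : Edge n) → T (touches e e)
  touches-refl (a , b) = T-∨ˡ _ (T-∨ˡ (a == b) (T-==-refl a))

  fresh-∷ : (u v : Fin n) (seen : List (Fin n)) (e : Edge n) →
    fresh (u ∷ v ∷ seen) e ≡ fresh seen e ∧ not (touches e (u , v))
  fresh-∷ u v seen (a , b) = trans (cong not (regroup (u == a) (v == a) (u == b) (v == b) (elem a seen) (elem b seen)))
    (not-∨ (elem a seen ∨ elem b seen) _)
    where
    open ∨-∧-Solver
    regroup : ∀ p₁ p₂ q₁ q₂ x y → (p₁ ∨ (p₂ ∨ x)) ∨ (q₁ ∨ (q₂ ∨ y)) ≡ (x ∨ y) ∨ ((p₁ ∨ q₁) ∨ (p₂ ∨ q₂))
    regroup = solve 6 (λ p₁ p₂ q₁ q₂ x y →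
      (p₁ :+ (p₂ :+ x)) :+ (q₁ :+ (q₂ :+ y)) := (x :+ y) :+ ((p₁ :+ q₁) :+ (p₂ :+ q₂))) refl
    not-∨ : ∀ x y → not (x ∨ y) ≡ not x ∧ not y
    not-∨ false y = refl
    not-∨ true y = refl

  firstIs-∷-fresh : (seen : List (Fin n)) (e x : Edge n) (xs : List (Edge n)) → x ≢ e →
    ⟦ fresh seen e ⟧ * ⟦ firstIs _≟ₑ_ (touches e) e (x ∷ xs) ⟧ ≡
    ⟦ fresh (proj₁ x ∷ proj₂ x ∷ seen) e ⟧ * ⟦ firstIs _≟ₑ_ (touches e) e xs ⟧
  firstIs-∷-fresh seen e (u , v) xs x≢e rewrite fresh-∷ u v seen e with touches e (u , v)
  ... | true rewrite ⌊≟⌋-≢ _≟ₑ_ x≢e | ∧-zeroʳ (fresh seen e) = *-zeroʳ ⟦ fresh seen e ⟧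
  ... | false rewrite ∧-identityʳ (fresh seen e) = refl

  bothNew≡∑fresh-firstIs : (σ : List (Edge n)) (seen : List (Fin n)) → Unique σ →
    bothNew seen σ ≡ ∑[ e ∈ σ ] (⟦ fresh seen e ⟧ * ⟦ firstIs _≟ₑ_ (touches e) e σ ⟧)
  bothNew≡∑fresh-firstIs [] seen _ = refl
  bothNew≡∑fresh-firstIs ((u , v) ∷ σ) seen (uv∉σ ∷ uniq) = cong₂ _+_ head (begin
    bothNew (u ∷ v ∷ seen) σ
      ≡⟨ bothNew≡∑fresh-firstIs σ (u ∷ v ∷ seen) uniq ⟩
    ∑[ e ∈ σ ] (⟦ fresh (u ∷ v ∷ seen) e ⟧ * ⟦ firstIs _≟ₑ_ (touches e) e σ ⟧)
      ≡⟨ ∑-cong σ (λ e e∈ → firstIs-∷-fresh seen e (u , v) σ (All.lookup uv∉σ e∈)) ⟨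
    ∑[ e ∈ σ ] (⟦ fresh seen e ⟧ * ⟦ firstIs _≟ₑ_ (touches e) e ((u , v) ∷ σ) ⟧) ∎)
    where
    head : ⟦ fresh seen (u , v) ⟧ ≡ ⟦ fresh seen (u , v) ⟧ * ⟦ firstIs _≟ₑ_ (touches (u , v)) (u , v) ((u , v) ∷ σ) ⟧
    head rewrite Equivalence.to T-≡ (touches-refl (u , v)) | ⌊≟⌋-refl _≟ₑ_ (u , v) = sym (*-identityʳ _)

  components-forestOf≡∑firstIs : (σ : List (Edge n)) → Unique σ → LoopFree σ → Covers σ →
    components (forestOf σ) ≡ ∑[ e ∈ σ ] ⟦ firstIs _≟ₑ_ (touches e) e σ ⟧
  components-forestOf≡∑firstIs σ uniq loopFree covers = begin
    components (forestOf σ)   ≡⟨ components-forestOf σ loopFree covers ⟩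
    bothNew [] σ              ≡⟨ bothNew≡∑fresh-firstIs σ [] uniq ⟩
    ∑[ e ∈ σ ] (⟦ fresh [] e ⟧ * ⟦ firstIs _≟ₑ_ (touches e) e σ ⟧)
                              ≡⟨ ∑-cong σ (λ e _ → +-identityʳ _) ⟩
    ∑[ e ∈ σ ] ⟦ firstIs _≟ₑ_ (touches e) e σ ⟧ ∎

  totalComponents-touch-regular : (L : List (Edge n)) → Unique L → LoopFree L → Covers L → (k : ℕ) →
    (∀ e → e ∈ L → ∑[ x ∈ L ] ⟦ touches e x ⟧ ≡ k) →
    k * totalComponents L ≡ length L * length (perms L)
  totalComponents-touch-regular L uniq loopFree covers k regular = begin
    k * ∑[ σ ∈ perms L ] components (forestOf σ)
      ≡⟨ cong (k *_) (∑-cong (perms L) λ σ σ∈ → count-firsts σ (∈-perms⇒↭ L σ∈)) ⟩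
    k * ∑[ σ ∈ perms L ] ∑[ e ∈ L ] ⟦ firstIs _≟ₑ_ (touches e) e σ ⟧
      ≡⟨ cong (k *_) (∑-comm (perms L) L _) ⟩
    k * ∑[ e ∈ L ] firsts _≟ₑ_ (touches e) e L
      ≡⟨ ∑-*ˡ L k _ ⟨
    ∑[ e ∈ L ] (k * firsts _≟ₑ_ (touches e) e L)
      ≡⟨ ∑-cong L (λ e e∈ → trans (cong (_* _) (sym (regular e e∈)))
                   (count*firsts≡|perms| _≟ₑ_ (touches e) e (Equivalence.to T-≡ (touches-refl e)) L uniq e∈)) ⟩
    ∑[ e ∈ L ] length (perms L)
      ≡⟨ ∑-const L _ ⟩
    length L * length (perms L) ∎
    where
    count-firsts : (σ : List (Edge n)) → σ ↭ L →
      components (forestOf σ) ≡ ∑[ e ∈ L ] ⟦ firstIs _≟ₑ_ (touches e) e σ ⟧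
    count-firsts σ σ↭L = begin
      components (forestOf σ)
        ≡⟨ components-forestOf≡∑firstIs σ
             (Unique-resp-↭ L↭σ uniq) (↭.All-resp-↭ L↭σ loopFree) (↭.Any-resp-↭ L↭σ ∘ covers) ⟩
      ∑[ e ∈ σ ] ⟦ firstIs _≟ₑ_ (touches e) e σ ⟧
        ≡⟨ ∑-↭ _ σ↭L ⟩
      ∑[ e ∈ L ] ⟦ firstIs _≟ₑ_ (touches e) e σ ⟧ ∎
      where
      L↭σ = ↭-sym σ↭L

-- The complete bipartite graph

module CompleteBipartite (s t : ℕ) where

  ℓ : Fin s → Fin (s + t)
  ℓ i = i ↑ˡ t

  r : Fin t → Fin (s + t)
  r j = s ↑ʳ j

  bipartiteEdges≡cartesianProductWith :
    bipartiteEdges s t ≡ cartesianProductWith (λ i j → (ℓ i , r j)) (allFin s) (allFin t)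
  bipartiteEdges≡cartesianProductWith = concatMap-map≡cartesianProductWith _ (allFin s) (allFin t)

  ∑-bipartiteEdges : (f : Edge (s + t) → ℕ) →
    ∑ (bipartiteEdges s t) f ≡ ∑[ i ∈ allFin s ] ∑[ j ∈ allFin t ] f (ℓ i , r j)
  ∑-bipartiteEdges f = trans (cong (λ L → ∑ L f) bipartiteEdges≡cartesianProductWith)
    (∑-cartesianProductWith _ (allFin s) (allFin t) f)

  ∈-bipartiteEdges⁻ : {e : Edge (s + t)} → e ∈ bipartiteEdges s t → ∃₂ λ i j → e ≡ (ℓ i , r j)
  ∈-bipartiteEdges⁻ e∈ with i , j , _ , _ , e≡ ← ∈-cartesianProductWith⁻ _ (allFin s) (allFin t)
    (subst (_ ∈_) bipartiteEdges≡cartesianProductWith e∈) = i , j , e≡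

  ∈-bipartiteEdges⁺ : (i : Fin s) (j : Fin t) → (ℓ i , r j) ∈ bipartiteEdges s t
  ∈-bipartiteEdges⁺ i j = subst ((ℓ i , r j) ∈_) (sym bipartiteEdges≡cartesianProductWith)
    (∈-cartesianProductWith⁺ _ (∈-allFin i) (∈-allFin j))

  ℓ≢r : (i : Fin s) (j : Fin t) → ℓ i ≢ r j
  ℓ≢r i j ℓi≡rj with trans (sym (splitAt-↑ˡ s i t)) (trans (cong (splitAt s) ℓi≡rj) (splitAt-↑ʳ s t j))
  ... | ()

  unique : Unique (bipartiteEdges s t)
  unique = subst Unique (sym bipartiteEdges≡cartesianProductWith)
    (Unique.cartesianProductWith⁺ _ (λ eq → ↑ˡ-injective t _ _ (cong proj₁ eq) , ↑ʳ-injective s _ _ (cong proj₂ eq))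
      (Unique.allFin⁺ s) (Unique.allFin⁺ t))

  loopFree : LoopFree (bipartiteEdges s t)
  loopFree = All.tabulate λ e∈ → case ∈-bipartiteEdges⁻ e∈ of λ { (i , j , refl) → ℓ≢r i j }

  covers : 1 ≤ s → 1 ≤ t → Covers (bipartiteEdges s t)
  covers (s≤s _) (s≤s _) w with splitAt s w in split
  ... | inj₁ i = Any.map (λ { refl → inj₁ (sym (splitAt⁻¹-↑ˡ split)) }) (∈-bipartiteEdges⁺ i Fin.zero)
  ... | inj₂ j = Any.map (λ { refl → inj₂ (sym (splitAt⁻¹-↑ʳ split)) }) (∈-bipartiteEdges⁺ Fin.zero j)

  length-bipartiteEdges : length (bipartiteEdges s t) ≡ s * t
  length-bipartiteEdges = begin
    length (bipartiteEdges s t)                 ≡⟨ length≡∑1 (bipartiteEdges s t) ⟩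
    ∑[ e ∈ bipartiteEdges s t ] 1               ≡⟨ ∑-bipartiteEdges _ ⟩
    ∑[ i ∈ allFin s ] ∑[ j ∈ allFin t ] 1       ≡⟨ ∑-cong (allFin s) (λ i _ → length≡∑1 (allFin t)) ⟨
    ∑[ i ∈ allFin s ] length (allFin t)         ≡⟨ ∑-const (allFin s) _ ⟩
    length (allFin s) * length (allFin t)       ≡⟨ cong₂ _*_ (length-allFin s) (length-allFin t) ⟩
    s * t                                       ∎

  touches-bipartite : (i₀ : Fin s) (j₀ : Fin t) →
    ∑[ x ∈ bipartiteEdges s t ] ⟦ touches (ℓ i₀ , r j₀) x ⟧ + 1 ≡ s + t
  touches-bipartite i₀ j₀ = begin
    ∑[ x ∈ bipartiteEdges s t ] ⟦ touches (ℓ i₀ , r j₀) x ⟧ + 1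
      ≡⟨ cong₂ _+_ (∑-bipartiteEdges _) (sym (cong₂ _*_ row column)) ⟩
    ∑[ i ∈ allFin s ] ∑[ j ∈ allFin t ] ⟦ p i ∨ q j ⟧ + ∑[ i ∈ allFin s ] ⟦ p i ⟧ * ∑[ j ∈ allFin t ] ⟦ q j ⟧
      ≡⟨ ∑∑-∨ (allFin s) (allFin t) p q ⟩
    length (allFin t) * ∑[ i ∈ allFin s ] ⟦ p i ⟧ + length (allFin s) * ∑[ j ∈ allFin t ] ⟦ q j ⟧
      ≡⟨ cong₂ _+_ (cong₂ _*_ (length-allFin t) row) (cong₂ _*_ (length-allFin s) column) ⟩
    t * 1 + s * 1
      ≡⟨ trans (cong₂ _+_ (*-identityʳ t) (*-identityʳ s)) (+-comm t s) ⟩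
    s + t ∎
    where
    p : Fin s → Bool
    p i = (ℓ i == ℓ i₀) ∨ (ℓ i == r j₀)
    q : Fin t → Bool
    q j = (r j == ℓ i₀) ∨ (r j == r j₀)
    row : ∑[ i ∈ allFin s ] ⟦ p i ⟧ ≡ 1
    row = begin
      ∑[ i ∈ allFin s ] ⟦ p i ⟧
        ≡⟨ ∑-cong (allFin s) (λ i _ → cong (λ b → ⟦ (ℓ i == ℓ i₀) ∨ b ⟧) (⌊≟⌋-≢ _≟_ (ℓ≢r i j₀))) ⟩
      ∑[ i ∈ allFin s ] ⟦ (ℓ i == ℓ i₀) ∨ false ⟧
        ≡⟨ ∑-cong (allFin s) (λ i _ → cong ⟦_⟧ (∨-identityʳ _)) ⟩
      ∑[ i ∈ allFin s ] ⟦ ℓ i == ℓ i₀ ⟧    ≡⟨ ∑-map ℓ (allFin s) _ ⟨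
      ∑[ x ∈ map ℓ (allFin s) ] ⟦ x == ℓ i₀ ⟧
        ≡⟨ ∑-δ₁ _≟_ (Unique.map⁺ (↑ˡ-injective t _ _) (Unique.allFin⁺ s)) (∈-map⁺ ℓ (∈-allFin i₀)) ⟩
      1 ∎
    column : ∑[ j ∈ allFin t ] ⟦ q j ⟧ ≡ 1
    column = begin
      ∑[ j ∈ allFin t ] ⟦ q j ⟧
        ≡⟨ ∑-cong (allFin t) (λ j _ → cong (λ b → ⟦ b ∨ (r j == r j₀) ⟧) (⌊≟⌋-≢ _≟_ (ℓ≢r i₀ j ∘ sym))) ⟩
      ∑[ j ∈ allFin t ] ⟦ r j == r j₀ ⟧    ≡⟨ ∑-map r (allFin t) _ ⟨
      ∑[ x ∈ map r (allFin t) ] ⟦ x == r j₀ ⟧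
        ≡⟨ ∑-δ₁ _≟_ (Unique.map⁺ (↑ʳ-injective s _ _) (Unique.allFin⁺ t)) (∈-map⁺ r (∈-allFin j₀)) ⟩
      1 ∎

  touch-regular : ∀ e → e ∈ bipartiteEdges s t → ∑[ x ∈ bipartiteEdges s t ] ⟦ touches e x ⟧ ≡ s + t ∸ 1
  touch-regular e e∈ with i₀ , j₀ , refl ← ∈-bipartiteEdges⁻ e∈ =
    trans (sym (m+n∸n≡m _ 1)) (cong (_∸ 1) (touches-bipartite i₀ j₀))

  expected-components : 1 ≤ s → 1 ≤ t →
    (s + t ∸ 1) * totalComponents (bipartiteEdges s t) ≡ s * t * length (perms (bipartiteEdges s t))
  expected-components 1≤s 1≤t = trans
    (totalComponents-touch-regular _ unique loopFree (covers 1≤s 1≤t) (s + t ∸ 1) touch-regular)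
    (cong (_* length (perms (bipartiteEdges s t))) length-bipartiteEdges)

-- The complete graph

module Complete (n : ℕ) where

  ascending? : (e : Edge n) → Dec (toℕ (proj₁ e) < toℕ (proj₂ e))
  ascending? (i , j) = toℕ i <? toℕ j

  completeEdges≡filter : completeEdges n ≡ filter ascending? (cartesianProduct (allFin n) (allFin n))
  completeEdges≡filter = rows (allFin n)
    where
    row : (i : Fin n) (js : List (Fin n)) →
      concatMap (λ j → if toℕ i <ᵇ toℕ j then (i , j) ∷ [] else []) js ≡ filter ascending? (map (i ,_) js)
    row i [] = refl
    row i (j ∷ js) with toℕ i <ᵇ toℕ j
    ... | true = cong ((i , j) ∷_) (row i js)
    ... | false = row i js
    rows : (is : List (Fin n)) →
      concatMap (λ i → concatMap (λ j → if toℕ i <ᵇ toℕ j then (i , j) ∷ [] else []) (allFin n)) is ≡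
      filter ascending? (cartesianProduct is (allFin n))
    rows [] = refl
    rows (i ∷ is) = trans (cong₂ _++_ (row i (allFin n)) (rows is))
      (sym (filter-++ ascending? (map (i ,_) (allFin n)) (cartesianProduct is (allFin n))))

  ∑-completeEdges : (f : Edge n → ℕ) →
    ∑ (completeEdges n) f ≡ ∑[ i ∈ allFin n ] ∑[ j ∈ allFin n ] (⟦ toℕ i <ᵇ toℕ j ⟧ * f (i , j))
  ∑-completeEdges f = begin
    ∑ (completeEdges n) f
      ≡⟨ cong (λ L → ∑ L f) completeEdges≡filter ⟩
    ∑ (filter ascending? (cartesianProduct (allFin n) (allFin n))) f
      ≡⟨ ∑-filter ascending? (cartesianProduct (allFin n) (allFin n)) f ⟩
    ∑[ e ∈ cartesianProduct (allFin n) (allFin n) ] (⟦ Dec.does (ascending? e) ⟧ * f e)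
      ≡⟨ ∑-cartesianProductWith _,_ (allFin n) (allFin n) _ ⟩
    ∑[ i ∈ allFin n ] ∑[ j ∈ allFin n ] (⟦ toℕ i <ᵇ toℕ j ⟧ * f (i , j)) ∎

  unique : Unique (completeEdges n)
  unique = subst Unique (sym completeEdges≡filter)
    (Unique.filter⁺ ascending? (Unique.cartesianProduct⁺ (Unique.allFin⁺ n) (Unique.allFin⁺ n)))

  loopFree : LoopFree (completeEdges n)
  loopFree = subst LoopFree (sym completeEdges≡filter)
    (All.map (λ i<j i≡j → <-irrefl (cong toℕ i≡j) i<j) (All.all-filter ascending? (cartesianProduct (allFin n) (allFin n))))

  ∈-completeEdges⁺ : {i j : Fin n} → toℕ i < toℕ j → (i , j) ∈ completeEdges n
  ∈-completeEdges⁺ i<j = subst (_ ∈_) (sym completeEdges≡filter)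
    (∈-filter⁺ ascending? (∈-cartesianProduct⁺ (∈-allFin _) (∈-allFin _)) i<j)

  covers : 2 ≤ n → Covers (completeEdges n)
  covers (s≤s (s≤s _)) Fin.zero = Any.map (λ { refl → inj₁ refl }) (∈-completeEdges⁺ {j = Fin.suc Fin.zero} (s≤s z≤n))
  covers (s≤s (s≤s _)) (Fin.suc w) = Any.map (λ { refl → inj₂ refl }) (∈-completeEdges⁺ {i = Fin.zero} (s≤s z≤n))

  ∑² : (Fin n → Fin n → ℕ) → ℕ
  ∑² h = ∑[ i ∈ allFin n ] ∑[ j ∈ allFin n ] h i j

  ∑²-+ : (g h : Fin n → Fin n → ℕ) → ∑² (λ i j → g i j + h i j) ≡ ∑² g + ∑² h
  ∑²-+ g h = trans (∑-cong (allFin n) λ i _ → ∑-+ (allFin n) (g i) (h i)) (∑-+ (allFin n) _ _)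

  trichotomy : (i j : Fin n) → ⟦ toℕ i <ᵇ toℕ j ⟧ + ⟦ toℕ j <ᵇ toℕ i ⟧ + ⟦ j == i ⟧ ≡ 1
  trichotomy i j with <-cmp (toℕ i) (toℕ j)
  ... | tri< i<j i≢j j≮i rewrite <ᵇ-true i<j | <ᵇ-false j≮i | ⌊≟⌋-≢ _≟_ (i≢j ∘ cong toℕ ∘ sym) = refl
  ... | tri> i≮j i≢j j<i rewrite <ᵇ-false i≮j | <ᵇ-true j<i | ⌊≟⌋-≢ _≟_ (i≢j ∘ cong toℕ ∘ sym) = refl
  ... | tri≈ i≮j i≡j _ rewrite toℕ-injective i≡j | <ᵇ-false i≮j | ⌊≟⌋-refl _≟_ j = refl

  ∑²-symmetric : (h : Fin n → Fin n → ℕ) → (∀ i j → h i j ≡ h j i) →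
    2 * ∑² (λ i j → ⟦ toℕ i <ᵇ toℕ j ⟧ * h i j) + ∑[ i ∈ allFin n ] h i i ≡ ∑² h
  ∑²-symmetric h symmetric = sym (begin
    ∑² h
      ≡⟨ ∑-cong (allFin n) (λ i _ → ∑-cong (allFin n) λ j _ → split i j) ⟩
    ∑² (λ i j → upper i j + upper j i + ⟦ j == i ⟧ * h i j)
      ≡⟨ trans (∑²-+ _ _) (cong (_+ ∑² (λ i j → ⟦ j == i ⟧ * h i j)) (∑²-+ upper (λ i j → upper j i))) ⟩
    ∑² upper + ∑² (λ i j → upper j i) + ∑² (λ i j → ⟦ j == i ⟧ * h i j)
      ≡⟨ cong₂ (λ x y → ∑² upper + x + y) (∑-comm (allFin n) (allFin n) (λ i j → upper j i))
           (∑-cong (allFin n) λ i _ → ∑-δ _≟_ (Unique.allFin⁺ n) (∈-allFin i) (h i)) ⟩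
    ∑² upper + ∑² upper + ∑[ i ∈ allFin n ] h i i
      ≡⟨ cong (λ x → ∑² upper + x + ∑[ i ∈ allFin n ] h i i) (sym (+-identityʳ (∑² upper))) ⟩
    2 * ∑² upper + ∑[ i ∈ allFin n ] h i i ∎)
    where
    upper : Fin n → Fin n → ℕ
    upper i j = ⟦ toℕ i <ᵇ toℕ j ⟧ * h i j
    split : ∀ i j → h i j ≡ upper i j + upper j i + ⟦ j == i ⟧ * h i j
    split i j = begin
      h i j
        ≡⟨ *-identityˡ (h i j) ⟨
      1 * h i j
        ≡⟨ cong (_* h i j) (trichotomy i j) ⟨
      (⟦ toℕ i <ᵇ toℕ j ⟧ + ⟦ toℕ j <ᵇ toℕ i ⟧ + ⟦ j == i ⟧) * h i j
        ≡⟨ trans (*-distribʳ-+ (h i j) (⟦ toℕ i <ᵇ toℕ j ⟧ + ⟦ toℕ j <ᵇ toℕ i ⟧) ⟦ j == i ⟧)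
             (cong (_+ ⟦ j == i ⟧ * h i j) (*-distribʳ-+ (h i j) ⟦ toℕ i <ᵇ toℕ j ⟧ ⟦ toℕ j <ᵇ toℕ i ⟧)) ⟩
      upper i j + ⟦ toℕ j <ᵇ toℕ i ⟧ * h i j + ⟦ j == i ⟧ * h i j
        ≡⟨ cong (λ x → upper i j + ⟦ toℕ j <ᵇ toℕ i ⟧ * x + ⟦ j == i ⟧ * h i j) (symmetric i j) ⟩
      upper i j + upper j i + ⟦ j == i ⟧ * h i j ∎

  ∑-allFin-1 : ∑[ x ∈ allFin n ] 1 ≡ n
  ∑-allFin-1 = trans (sym (length≡∑1 (allFin n))) (length-allFin n)

  twice-length : 2 * length (completeEdges n) + n ≡ n * n
  twice-length = begin
    2 * length (completeEdges n) + n
      ≡⟨ cong₂ (λ x y → 2 * x + y)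
           (trans (length≡∑1 (completeEdges n)) (∑-completeEdges (λ _ → 1))) (sym ∑-allFin-1) ⟩
    2 * ∑² (λ i j → ⟦ toℕ i <ᵇ toℕ j ⟧ * 1) + ∑[ i ∈ allFin n ] 1
      ≡⟨ ∑²-symmetric (λ _ _ → 1) (λ _ _ → refl) ⟩
    ∑[ i ∈ allFin n ] ∑[ j ∈ allFin n ] 1
      ≡⟨ trans (∑-cong (allFin n) λ _ _ → ∑-allFin-1) (∑-const (allFin n) n) ⟩
    length (allFin n) * n
      ≡⟨ cong (_* n) (length-allFin n) ⟩
    n * n ∎

  ∑-ends : (a b : Fin n) → a ≢ b → ∑[ x ∈ allFin n ] ⟦ (x == a) ∨ (x == b) ⟧ ≡ 2
  ∑-ends a b a≢b = +-cancelʳ-≡ 0 _ _ (begin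
    ∑[ x ∈ allFin n ] ⟦ (x == a) ∨ (x == b) ⟧ + 0
      ≡⟨ cong (count-ab +_) no-overlap ⟨
    ∑[ x ∈ allFin n ] ⟦ (x == a) ∨ (x == b) ⟧ + ∑[ x ∈ allFin n ] (⟦ x == a ⟧ * ⟦ x == b ⟧)
      ≡⟨ ∑-+ (allFin n) _ _ ⟨
    ∑[ x ∈ allFin n ] (⟦ (x == a) ∨ (x == b) ⟧ + ⟦ x == a ⟧ * ⟦ x == b ⟧)
      ≡⟨ ∑-cong (allFin n) (λ x _ → ⟦∨⟧+⟦∧⟧ (x == a) (x == b)) ⟩
    ∑[ x ∈ allFin n ] (⟦ x == a ⟧ + ⟦ x == b ⟧)
      ≡⟨ trans (∑-+ (allFin n) _ _) (cong₂ _+_ (δ a) (δ b)) ⟩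
    2 ∎)
    where
    count-ab = ∑[ x ∈ allFin n ] ⟦ (x == a) ∨ (x == b) ⟧
    δ : (m : Fin n) → ∑[ x ∈ allFin n ] ⟦ x == m ⟧ ≡ 1
    δ m = ∑-δ₁ _≟_ (Unique.allFin⁺ n) (∈-allFin m)
    no-overlap : ∑[ x ∈ allFin n ] (⟦ x == a ⟧ * ⟦ x == b ⟧) ≡ 0
    no-overlap = trans (∑-δ _≟_ (Unique.allFin⁺ n) (∈-allFin a) (λ x → ⟦ x == b ⟧))
      (cong ⟦_⟧ (⌊≟⌋-≢ _≟_ a≢b))

  touches-complete : (a b : Fin n) → a ≢ b → 2 * ∑[ x ∈ completeEdges n ] ⟦ touches (a , b) x ⟧ + 2 + 4 ≡ 4 * n
  touches-complete a b a≢b = begin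
    2 * ∑[ x ∈ completeEdges n ] ⟦ touches (a , b) x ⟧ + 2 + 4
      ≡⟨ cong₂ (λ x y → 2 * x + y + 2 * 2) (∑-completeEdges (λ x → ⟦ touches (a , b) x ⟧)) (sym diagonal) ⟩
    2 * ∑² (λ i j → ⟦ toℕ i <ᵇ toℕ j ⟧ * ⟦ S i ∨ S j ⟧) + ∑[ i ∈ allFin n ] ⟦ S i ∨ S i ⟧ + 2 * 2
      ≡⟨ cong (_+ 2 * 2) (∑²-symmetric (λ i j → ⟦ S i ∨ S j ⟧) (λ i j → cong ⟦_⟧ (∨-comm (S i) (S j)))) ⟩
    ∑² (λ i j → ⟦ S i ∨ S j ⟧) + 2 * 2
      ≡⟨ cong (λ c → ∑² (λ i j → ⟦ S i ∨ S j ⟧) + c * c) (∑-ends a b a≢b) ⟨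
    ∑² (λ i j → ⟦ S i ∨ S j ⟧) + ∑[ i ∈ allFin n ] ⟦ S i ⟧ * ∑[ j ∈ allFin n ] ⟦ S j ⟧
      ≡⟨ ∑∑-∨ (allFin n) (allFin n) S S ⟩
    length (allFin n) * ∑[ i ∈ allFin n ] ⟦ S i ⟧ + length (allFin n) * ∑[ j ∈ allFin n ] ⟦ S j ⟧
      ≡⟨ cong₂ (λ l c → l * c + l * c) (length-allFin n) (∑-ends a b a≢b) ⟩
    n * 2 + n * 2
      ≡⟨ n*2+n*2≡4*n n ⟩
    4 * n ∎
    where
    S : Fin n → Bool
    S x = (x == a) ∨ (x == b)
    diagonal : ∑[ i ∈ allFin n ] ⟦ S i ∨ S i ⟧ ≡ 2
    diagonal = trans (∑-cong (allFin n) λ i _ → cong ⟦_⟧ (∨-idem (S i))) (∑-ends a b a≢b)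
    n*2+n*2≡4*n : ∀ n → n * 2 + n * 2 ≡ 4 * n
    n*2+n*2≡4*n = solve-∀

  touch-regular : ∀ e → e ∈ completeEdges n → ∑[ x ∈ completeEdges n ] ⟦ touches e x ⟧ ≡ 2 * n ∸ 3
  touch-regular (a , b) e∈ = sym (trans (cong (_∸ 3) two-n) (m+n∸n≡m count 3))
    where
    count = ∑[ x ∈ completeEdges n ] ⟦ touches (a , b) x ⟧
    two-n : 2 * n ≡ count + 3
    two-n = *-cancelˡ-≡ (2 * n) (count + 3) 2 (begin
      2 * (2 * n)        ≡⟨ double n ⟩
      4 * n              ≡⟨ touches-complete a b (All.lookup loopFree e∈) ⟨
      2 * count + 2 + 4  ≡⟨ double-+3 count ⟩
      2 * (count + 3)    ∎)
      where
      double : ∀ n → 2 * (2 * n) ≡ 4 * n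
      double = solve-∀
      double-+3 : ∀ c → 2 * c + 2 + 4 ≡ 2 * (c + 3)
      double-+3 = solve-∀

  expected-components : 2 ≤ n →
    (4 * n ∸ 6) * totalComponents (completeEdges n) ≡ n * (n ∸ 1) * length (perms (completeEdges n))
  expected-components 2≤n = begin
    (4 * n ∸ 6) * total                  ≡⟨ cong (_* total) four-n∸6 ⟩
    2 * (2 * n ∸ 3) * total              ≡⟨ *-assoc 2 (2 * n ∸ 3) total ⟩
    2 * ((2 * n ∸ 3) * total)
      ≡⟨ cong (2 *_) (totalComponents-touch-regular _ unique loopFree (covers 2≤n) _ touch-regular) ⟩
    2 * (length L * length (perms L))    ≡⟨ *-assoc 2 (length L) _ ⟨
    2 * length L * length (perms L)      ≡⟨ cong (_* length (perms L)) n[n∸1] ⟨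
    n * (n ∸ 1) * length (perms L)       ∎
    where
    L = completeEdges n
    total = totalComponents L
    four-n∸6 : 4 * n ∸ 6 ≡ 2 * (2 * n ∸ 3)
    four-n∸6 = trans (cong (_∸ 6) (double n)) (sym (*-distribˡ-∸ 2 (2 * n) 3))
      where
      double : ∀ n → 4 * n ≡ 2 * (2 * n)
      double = solve-∀
    n[n∸1] : n * (n ∸ 1) ≡ 2 * length L
    n[n∸1] = begin
      n * (n ∸ 1)             ≡⟨ *-distribˡ-∸ n n 1 ⟩
      n * n ∸ n * 1           ≡⟨ cong₂ _∸_ (sym twice-length) (*-identityʳ n) ⟩
      2 * length L + n ∸ n    ≡⟨ m+n∸n≡m _ n ⟩
      2 * length L            ∎

corollary4 :
  ((n : ℕ) → n ≥ 2 →
    (4 * n ∸ 6) * totalComponents (completeEdges n) ≡ n * (n ∸ 1) * length (perms (completeEdges n)))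
  × ((s t : ℕ) → s ≥ 1 → t ≥ 1 →
    (s + t ∸ 1) * totalComponents (bipartiteEdges s t) ≡ s * t * length (perms (bipartiteEdges s t)))
corollary4 = Complete.expected-components , CompleteBipartite.expected-components
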